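{- Let $Q$ be a weak primary pseudoperfect number and let $\mathfrak{N}_Q=\{n\in\mathbb{N}: S_{Qn}(Qn)\equiv n\pmod{Qn}\}$. Then $\mathfrak{N}_Q$ has an asymptotic density $\delta(\mathfrak{N}_Q)$, and $\delta(\mathfrak{N}_Q)<1/\mathfrak{n}_Q$, where $$\mathfrak{n}_Q:=\begin{cases}\operatorname{lcm}\left\{\frac{p-1}{\gcd(p-1,Q)} : p \text{ prime}, p\mid Q\right\}, & Q\neq 1,\\ 1, & Q=1.\end{cases}$$
   Context: $\mathbb{N}=\{1,2,3,\dots\}$. For positive integers $m,k$, $S_m(k):=1^m+2^m+\cdots+k^m$. A positive integer $Q$ is a weak primary pseudoperfect number if $\sum_{p\mid Q}\frac{Q}{p}+1\equiv 0\pmod{Q}$, the sum over primes $p$ dividing $Q$. The asymptotic density of $A\subseteq\mathbb{N}$ is $\lim_{N\to\infty}\frac{\#(A\cap[1,N])}{N}$ when this limit exists. -}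

module Defs where

open import Data.Nat as ℕ using (ℕ; zero; suc; _+_; _*_; _∸_; _^_; _/_; NonZero)
open import Data.Nat.Divisibility as ℕD using (_∣?_; 0∣⇒≡0; m∣m*n; n∣m*n; n/m≡quotient; quotient≢0)
open import Data.Nat.GCD using (gcd; gcd[m,n]≢0; gcd[m,n]∣m)
open import Data.Nat.LCM using (lcm; lcm-least)
open import Data.Nat.Primality using (Prime; prime?)
open import Data.Integer as ℤ using (ℤ; +_)
open import Data.Integer.Divisibility.Signed as ℤD using ()
open import Data.Rational as ℚ using (ℚ)
open import Data.Product using (_×_; _,_; proj₁)
open import Data.Empty using (⊥)
open import Data.Nat.Properties using (m*n≢0)
open import Data.Sum using (inj₁)
open import Relation.Binary.PropositionalEquality using (_≡_; subst; sym)
open import Relation.Nullary using (yes; no)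
open import Relation.Nullary.Decidable using (_×-dec_)

S : ℕ → ℕ → ℕ
S m zero    = 0
S m (suc k) = S m k + suc k ^ m

primeQuotSum : (Q : ℕ) → ℕ → ℕ
primeQuotSum Q zero = 0
primeQuotSum Q (suc k) with prime? (suc k) ×-dec (suc k ∣? Q)
... | yes _ = Q / suc k + primeQuotSum Q k
... | no  _ = primeQuotSum Q k

-- Σ_{p ∣ Q, p prime} Q/p   (all prime divisors of a positive Q are ≤ Q)
primeDivSum : ℕ → ℕ
primeDivSum Q = primeQuotSum Q Q

WeakPrimaryPseudoperfect : ℕ → Set
WeakPrimaryPseudoperfect Q = (1 ℕ.≤ Q) × (Q ℕD.∣ (primeDivSum Q + 1))

gcdNZ : ∀ j Q → NonZero (gcd (suc j) Q)
gcdNZ j Q = ℕ.≢-nonZero (gcd[m,n]≢0 (suc j) Q (inj₁ λ ()))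

-- (p - 1) / gcd (p - 1, Q) for a prime p
term : (p : ℕ) → Prime p → ℕ → ℕ
term (suc (suc j)) _ Q = (suc j / gcd (suc j) Q) {{gcdNZ j Q}}

lcmTerms : (Q : ℕ) → ℕ → ℕ
lcmTerms Q zero = 1
lcmTerms Q (suc k) with prime? (suc k) ×-dec (suc k ∣? Q)
... | yes (pr , _) = lcm (term (suc k) pr Q) (lcmTerms Q k)
... | no  _        = lcmTerms Q k

𝔫 : ℕ → ℕ
𝔫 (suc zero) = 1
𝔫 Q          = lcmTerms Q Q

lcm≢0 : ∀ m n → .{{NonZero m}} → .{{NonZero n}} → NonZero (lcm m n)
lcm≢0 m n = ℕ.≢-nonZero λ eq →
  ℕ.≢-nonZero⁻¹ (m * n) {{m*n≢0 m n}}
    (0∣⇒≡0 (subst (ℕD._∣ (m * n)) eq (lcm-least (m∣m*n {m} n) (n∣m*n m {n}))))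

term≢0 : (p : ℕ) (pr : Prime p) (Q : ℕ) → NonZero (term p pr Q)
term≢0 (suc (suc j)) _ Q =
  subst NonZero (sym (n/m≡quotient g∣ {{gcdNZ j Q}})) (quotient≢0 g∣)
  where
  g∣ = gcd[m,n]∣m (suc j) Q

lcmTerms≢0 : ∀ Q k → NonZero (lcmTerms Q k)
lcmTerms≢0 Q zero = _
lcmTerms≢0 Q (suc k) with prime? (suc k) ×-dec (suc k ∣? Q)
... | yes (pr , _) = lcm≢0 _ _ {{term≢0 (suc k) pr Q}} {{lcmTerms≢0 Q k}}
... | no  _        = lcmTerms≢0 Q k

𝔫≢0 : ∀ Q → NonZero (𝔫 Q)
𝔫≢0 zero = _
𝔫≢0 (suc zero) = _
𝔫≢0 (suc (suc Q)) = lcmTerms≢0 (suc (suc Q)) (suc (suc Q))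

inv𝔫 : ℕ → ℚ
inv𝔫 Q = (+ 1 ℚ./ 𝔫 Q) {{𝔫≢0 Q}}

In𝔑 : ℕ → ℕ → Set
In𝔑 Q n = (+ (Q * n)) ℤD.∣ (+ S (Q * n) (Q * n) ℤ.- + n)

count : ℕ → ℕ → ℕ
count Q zero = 0
count Q (suc N) with (+ (Q * suc N)) ℤD.∣? (+ S (Q * suc N) (Q * suc N) ℤ.- + suc N)
... | yes _ = suc (count Q N)
... | no  _ = count Q N

-- counting ratio #(𝔑_Q ∩ [1, N+1]) / (N+1)
ratio : ℕ → ℕ → ℚ
ratio Q N = + count Q (suc N) ℚ./ suc N

{-# OPTIONS --safe #-}
-- Write M = Q n. For a prime power p ^ e ∣ M, reducing the bases of S_M(M) mod p and lifting
-- through (x ^ p) ≡ (y ^ p) mod p ^ (e + 1) shows S_M(M) ≡ (M / p) ∑_{r < p} r ^ M, and the inner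
-- sum is ≡ -1 or 0 mod p according as p - 1 ∣ M or not. Since Q is weak primary pseudoperfect,
-- p ∣ Q / p + 1 for every p ∣ Q, and n ∈ 𝔑_Q becomes a condition on the primes p ∣ Q n:
-- p - 1 ∣ Q n when p ∣ Q, and p - 1 ∤ Q n when p ∤ Q and p ∣ n.
-- Imposing these conditions only for p ≤ P gives a set A_P that is periodic mod P !, and the
-- n ∈ A_P outside 𝔑_Q satisfy p (p - 1) ∣ Q n for some prime p > P, a set of upper density at
-- most ∑_{j > P} Q / (j (j - 1)) = Q / P; so the counting ratios of 𝔑_Q are Cauchy. Finally every
-- n ∈ 𝔑_Q is a multiple of 𝔫_Q but not of L = 𝔫_Q p₀ (p₀ - 1) for a prime p₀ ∤ Q, which
-- bounds the density by 1 / 𝔫_Q - 1 / L.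
module Submission where

open import Defs
open import Data.Nat as ℕ using (ℕ; zero; suc)
import Data.Nat.Properties as ℕP
open import Data.Integer as ℤ using (ℤ; 0ℤ; 1ℤ)
import Data.Integer.Properties as ℤP
open import Data.Integer.Divisibility.Signed as ℤD using (divides)
open import Relation.Binary.PropositionalEquality

module Congruence where

  open import Data.Integer using (_+_; _*_; _-_; -_; _^_)
  open import Data.Integer.Divisibility.Signed using (_∣_)
  open import Data.Integer.Tactic.RingSolver using (solve-∀)

  infix 4 _≡_mod_

  record _≡_mod_ (a b d : ℤ) : Set where
    constructor from-∣
    field to-∣ : d ∣ a - b
  open _≡_mod_ public

  ≡⇒≡mod : ∀ {d a b} → a ≡ b → a ≡ b mod d
  ≡⇒≡mod {d} {a} refl = from-∣ (divides 0ℤ (trans (ℤP.+-inverseʳ a) (sym (ℤP.*-zeroˡ d))))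

  ≡mod-refl : ∀ {d a} → a ≡ a mod d
  ≡mod-refl = ≡⇒≡mod refl

  ≡mod-sym : ∀ {d a b} → a ≡ b mod d → b ≡ a mod d
  ≡mod-sym {d} {a} {b} (from-∣ h) = from-∣ (subst (d ∣_) (lemma a b) (ℤD.∣m⇒∣-m h))
    where
    lemma : ∀ a b → - (a - b) ≡ b - a
    lemma = solve-∀

  ≡mod-trans : ∀ {d a b c} → a ≡ b mod d → b ≡ c mod d → a ≡ c mod d
  ≡mod-trans {d} {a} {b} {c} (from-∣ h) (from-∣ k) = from-∣ (subst (d ∣_) (lemma a b c) (ℤD.∣m∣n⇒∣m+n h k))
    where
    lemma : ∀ a b c → (a - b) + (b - c) ≡ a - c
    lemma = solve-∀

  +-cong-mod : ∀ {d a b c e} → a ≡ b mod d → c ≡ e mod d → a + c ≡ b + e mod d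
  +-cong-mod {d} {a} {b} {c} {e} (from-∣ h) (from-∣ k) = from-∣ (subst (d ∣_) (lemma a b c e) (ℤD.∣m∣n⇒∣m+n h k))
    where
    lemma : ∀ a b c e → (a - b) + (c - e) ≡ (a + c) - (b + e)
    lemma = solve-∀

  *-cong-mod : ∀ {d a b c e} → a ≡ b mod d → c ≡ e mod d → a * c ≡ b * e mod d
  *-cong-mod {d} {a} {b} {c} {e} (from-∣ h) (from-∣ k) =
    from-∣ (subst (d ∣_) (lemma a b c e) (ℤD.∣m∣n⇒∣m+n (ℤD.∣m⇒∣m*n c h) (ℤD.∣n⇒∣m*n b k)))
    where
    lemma : ∀ a b c e → (a - b) * c + b * (c - e) ≡ a * c - b * e
    lemma = solve-∀

  ^-cong-mod : ∀ {d a b} n → a ≡ b mod d → a ^ n ≡ b ^ n mod d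
  ^-cong-mod zero    h = ≡mod-refl
  ^-cong-mod (suc n) h = *-cong-mod h (^-cong-mod n h)

  *-scale-mod : ∀ {d a b} c → a ≡ b mod d → c * a ≡ c * b mod c * d
  *-scale-mod {d} {a} {b} c (from-∣ (divides q eq)) =
    from-∣ (divides q (trans (lemma₁ c a b) (trans (cong (c *_) eq) (lemma₂ c q d))))
    where
    lemma₁ : ∀ c a b → c * a - c * b ≡ c * (a - b)
    lemma₁ = solve-∀
    lemma₂ : ∀ c q d → c * (q * d) ≡ q * (c * d)
    lemma₂ = solve-∀

  ≡mod-weaken : ∀ {d d′ a b} → d′ ∣ d → a ≡ b mod d → a ≡ b mod d′
  ≡mod-weaken h (from-∣ k) = from-∣ (ℤD.∣-trans h k)

  ≡mod0⇒∣ : ∀ {d a} → a ≡ 0ℤ mod d → d ∣ a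
  ≡mod0⇒∣ {d} {a} (from-∣ h) = subst (d ∣_) (ℤP.+-identityʳ a) h

  ∣⇒≡mod0 : ∀ {d a} → d ∣ a → a ≡ 0ℤ mod d
  ∣⇒≡mod0 {d} {a} h = from-∣ (subst (d ∣_) (sym (ℤP.+-identityʳ a)) h)

  ≡mod-cancel-+ : ∀ {d x y a} → x + a ≡ 0ℤ mod d → y + a ≡ 0ℤ mod d → x ≡ y mod d
  ≡mod-cancel-+ {d} {x} {y} {a} (from-∣ h) (from-∣ k) = from-∣ (subst (d ∣_) (lemma x y a) (ℤD.∣m∣n⇒∣m-n h k))
    where
    lemma : ∀ x y a → (x + a - 0ℤ) - (y + a - 0ℤ) ≡ x - y
    lemma = solve-∀

module Sum where

  open import Data.Integer using (+_; _+_; _*_; _^_)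
  open import Data.Integer.Tactic.RingSolver using (solve-∀)
  open Congruence

  ∑[<_] : ℕ → (ℕ → ℤ) → ℤ
  ∑[< zero  ] f = 0ℤ
  ∑[< suc n ] f = ∑[< n ] f + f n

  ∑-cong-mod : ∀ {d} n {f g : ℕ → ℤ} → (∀ i → i ℕ.< n → f i ≡ g i mod d) → ∑[< n ] f ≡ ∑[< n ] g mod d
  ∑-cong-mod zero    h = ≡mod-refl
  ∑-cong-mod (suc n) h = +-cong-mod (∑-cong-mod n (λ i i<n → h i (ℕP.m<n⇒m<1+n i<n))) (h n ℕP.≤-refl)

  ∑-cong : ∀ n {f g : ℕ → ℤ} → (∀ i → i ℕ.< n → f i ≡ g i) → ∑[< n ] f ≡ ∑[< n ] g
  ∑-cong zero    h = refl
  ∑-cong (suc n) h = cong₂ _+_ (∑-cong n (λ i i<n → h i (ℕP.m<n⇒m<1+n i<n))) (h n ℕP.≤-refl)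

  ∑-distrib-+ : ∀ n (f g : ℕ → ℤ) → ∑[< n ] (λ i → f i + g i) ≡ ∑[< n ] f + ∑[< n ] g
  ∑-distrib-+ zero    f g = refl
  ∑-distrib-+ (suc n) f g rewrite ∑-distrib-+ n f g = lemma (∑[< n ] f) (∑[< n ] g) (f n) (g n)
    where
    lemma : ∀ a b c e → a + b + (c + e) ≡ a + c + (b + e)
    lemma = solve-∀

  ∑-distribˡ-* : ∀ n c (f : ℕ → ℤ) → ∑[< n ] (λ i → c * f i) ≡ c * ∑[< n ] f
  ∑-distribˡ-* zero    c f = sym (ℤP.*-zeroʳ c)
  ∑-distribˡ-* (suc n) c f rewrite ∑-distribˡ-* n c f = sym (ℤP.*-distribˡ-+ c (∑[< n ] f) (f n))

  ∑-suc : ∀ n (f : ℕ → ℤ) → ∑[< suc n ] f ≡ f 0 + ∑[< n ] (λ i → f (suc i))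
  ∑-suc zero    f = ℤP.+-comm 0ℤ (f 0)
  ∑-suc (suc n) f rewrite ∑-suc n f = ℤP.+-assoc (f 0) _ _

  ∑-+ : ∀ a b (f : ℕ → ℤ) → ∑[< a ℕ.+ b ] f ≡ ∑[< a ] f + ∑[< b ] (λ i → f (a ℕ.+ i))
  ∑-+ a zero    f rewrite ℕP.+-identityʳ a = sym (ℤP.+-identityʳ _)
  ∑-+ a (suc b) f rewrite ℕP.+-suc a b | ∑-+ a b f = ℤP.+-assoc (∑[< a ] f) _ _

  ∑-const : ∀ n c → ∑[< n ] (λ _ → c) ≡ + n * c
  ∑-const zero    c = sym (ℤP.*-zeroˡ c)
  ∑-const (suc n) c rewrite ∑-const n c = lemma (+ n) c
    where
    lemma : ∀ n c → n * c + c ≡ (1ℤ + n) * c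
    lemma = solve-∀

  ∑-comm : ∀ m n (f : ℕ → ℕ → ℤ) → ∑[< m ] (λ i → ∑[< n ] (f i)) ≡ ∑[< n ] (λ j → ∑[< m ] (λ i → f i j))
  ∑-comm zero    n f = trans (sym (ℤP.*-zeroʳ (+ n))) (sym (∑-const n 0ℤ))
  ∑-comm (suc m) n f rewrite ∑-comm m n f = sym (∑-distrib-+ n (λ j → ∑[< m ] (λ i → f i j)) (λ j → f m j))

module Binomial where

  open import Data.Integer using (+_; _+_; _*_; _^_)
  open import Data.Nat.Combinatorics using (_C_; nC1≡n; k>n⇒nCk≡0; nCk≡nC[n∸k]; nCk+nC[k+1]≡[n+1]C[k+1])
  open import Data.Integer.Tactic.RingSolver using (solve-∀)
  open Sum

  [k+1]*[n+1]C[k+1]≡[n+1]*nCk : ∀ n k → suc k ℕ.* (suc n C suc k) ≡ suc n ℕ.* (n C k)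
  [k+1]*[n+1]C[k+1]≡[n+1]*nCk zero zero = refl
  [k+1]*[n+1]C[k+1]≡[n+1]*nCk zero (suc k) = ℕP.*-zeroʳ (suc (suc k))
  [k+1]*[n+1]C[k+1]≡[n+1]*nCk (suc n) zero = trans (ℕP.*-identityˡ _) (trans (nC1≡n (suc (suc n))) (sym (ℕP.*-identityʳ _)))
  [k+1]*[n+1]C[k+1]≡[n+1]*nCk (suc n) (suc k) = begin
    suc (suc k) ℕ.* (suc (suc n) C suc (suc k))
      ≡⟨ cong (suc (suc k) ℕ.*_) (sym (nCk+nC[k+1]≡[n+1]C[k+1] (suc n) (suc k))) ⟩
    suc (suc k) ℕ.* (suc n C suc k ℕ.+ suc n C suc (suc k))
      ≡⟨ ℕP.*-distribˡ-+ (suc (suc k)) (suc n C suc k) (suc n C suc (suc k)) ⟩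
    suc n C suc k ℕ.+ suc k ℕ.* (suc n C suc k) ℕ.+ suc (suc k) ℕ.* (suc n C suc (suc k))
      ≡⟨ cong₂ (λ a b → suc n C suc k ℕ.+ a ℕ.+ b) ([k+1]*[n+1]C[k+1]≡[n+1]*nCk n k) ([k+1]*[n+1]C[k+1]≡[n+1]*nCk n (suc k)) ⟩
    suc n C suc k ℕ.+ suc n ℕ.* (n C k) ℕ.+ suc n ℕ.* (n C suc k)
      ≡⟨ trans (ℕP.+-assoc (suc n C suc k) _ _) (cong (suc n C suc k ℕ.+_) (sym (ℕP.*-distribˡ-+ (suc n) (n C k) (n C suc k)))) ⟩
    suc n C suc k ℕ.+ suc n ℕ.* (n C k ℕ.+ n C suc k)
      ≡⟨ cong (λ c → suc n C suc k ℕ.+ suc n ℕ.* c) (nCk+nC[k+1]≡[n+1]C[k+1] n k) ⟩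
    suc (suc n) ℕ.* (suc n C suc k) ∎
    where open ≡-Reasoning

  [n+1]Cn≡n+1 : ∀ n → suc n C n ≡ suc n
  [n+1]Cn≡n+1 n = trans (nCk≡nC[n∸k] (ℕP.n≤1+n n)) (trans (cong (suc n C_) (ℕP.m+n∸n≡m 1 n)) (nC1≡n (suc n)))

  binomialTerm : ℕ → ℤ → ℕ → ℤ
  binomialTerm n x j = + (n C j) * x ^ j

  binomial-theorem : ∀ n x → (x + 1ℤ) ^ n ≡ ∑[< suc n ] (binomialTerm n x)
  binomial-theorem zero    x = refl
  binomial-theorem (suc n) x = begin
    (x + 1ℤ) * (x + 1ℤ) ^ n
      ≡⟨ cong ((x + 1ℤ) *_) (binomial-theorem n x) ⟩
    (x + 1ℤ) * ∑[< suc n ] t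
      ≡⟨ ℤP.*-distribʳ-+ (∑[< suc n ] t) x 1ℤ ⟩
    x * ∑[< suc n ] t + 1ℤ * ∑[< suc n ] t
      ≡⟨ cong₂ _+_ (sym (∑-distribˡ-* (suc n) x t)) (trans (ℤP.*-identityˡ _) (∑-suc n t)) ⟩
    ∑[< suc n ] (λ j → x * t j) + (1ℤ + ∑[< n ] (λ j → t (suc j)))
      ≡⟨ cong (λ z → ∑[< suc n ] (λ j → x * t j) + (1ℤ + z)) top-vanishes ⟩
    ∑[< suc n ] (λ j → x * t j) + (1ℤ + ∑[< suc n ] (λ j → t (suc j)))
      ≡⟨ lemma (∑[< suc n ] (λ j → x * t j)) (∑[< suc n ] (λ j → t (suc j))) ⟩
    1ℤ + (∑[< suc n ] (λ j → x * t j) + ∑[< suc n ] (λ j → t (suc j)))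
      ≡⟨ cong (λ z → 1ℤ + z) (sym (∑-distrib-+ (suc n) _ _)) ⟩
    1ℤ + ∑[< suc n ] (λ j → x * t j + t (suc j))
      ≡⟨ cong (λ z → 1ℤ + z) (∑-cong (suc n) (λ j _ → pascal j)) ⟩
    1ℤ + ∑[< suc n ] (λ j → binomialTerm (suc n) x (suc j))
      ≡⟨ sym (∑-suc (suc n) (binomialTerm (suc n) x)) ⟩
    ∑[< suc (suc n) ] (binomialTerm (suc n) x) ∎
    where
    open ≡-Reasoning
    t : ℕ → ℤ
    t = binomialTerm n x
    lemma : ∀ a b → a + (1ℤ + b) ≡ 1ℤ + (a + b)
    lemma = solve-∀
    top-vanishes : ∑[< n ] (λ j → t (suc j)) ≡ ∑[< suc n ] (λ j → t (suc j))
    top-vanishes rewrite k>n⇒nCk≡0 (ℕP.n<1+n n) =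
      sym (trans (cong (λ z → ∑[< n ] (λ j → t (suc j)) + z) (ℤP.*-zeroˡ (x ^ suc n))) (ℤP.+-identityʳ _))
    pascal : ∀ j → x * t j + t (suc j) ≡ binomialTerm (suc n) x (suc j)
    pascal j = begin
      x * (+ (n C j) * x ^ j) + + (n C suc j) * (x * x ^ j)
        ≡⟨ lemma′ x (+ (n C j)) (x ^ j) (+ (n C suc j)) ⟩
      (+ (n C j) + + (n C suc j)) * (x * x ^ j)
        ≡⟨ cong (_* (x * x ^ j)) (trans (sym (ℤP.pos-+ (n C j) (n C suc j))) (cong +_ (nCk+nC[k+1]≡[n+1]C[k+1] n j))) ⟩
      + (suc n C suc j) * (x * x ^ j) ∎
      where
      lemma′ : ∀ x a y b → x * (a * y) + b * (x * y) ≡ (a + b) * (x * y)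
      lemma′ = solve-∀

module Primes where

  open import Data.Integer using (+_)
  open import Data.Nat using (_+_; _*_; _^_; _∸_; _≤_; _<_; _!; z≤n; s≤s; NonZero)
  open import Data.Nat.Divisibility using (_∣_; divides; _∣?_; ∣-trans; ∣⇒≤; quotient; m∣n⇒n≡quotient*m; *-monoˡ-∣; m*n∣⇒n∣; *-cancelʳ-∣; ∣m+n∣m⇒∣n; m≤n⇒m!∣n!)
  open import Data.Nat.Primality using (Prime; euclidsLemma; prime⇒irreducible; prime⇒nonZero; prime⇒nonTrivial)
  open import Data.Nat.Primality.Factorisation using (factorise)
  open import Data.Nat.Induction using (<-rec)
  open import Data.Nat.ListAction using (product)
  open import Data.List using ([]; _∷_)
  open import Data.List.Relation.Unary.All using (_∷_)
  open import Data.Nat.Combinatorics using (_C_)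
  open import Data.Integer.Divisibility.Signed using (∣⇒∣ᵤ; ∣ᵤ⇒∣)
  open import Data.Product using (Σ; _×_; _,_)
  open import Data.Sum using (inj₁; inj₂)
  open import Data.Empty using (⊥-elim)
  open import Relation.Nullary using (¬_; yes; no)
  open Binomial using ([k+1]*[n+1]C[k+1]≡[n+1]*nCk)

  prime⇒≡2+ : ∀ {p} → Prime p → Σ ℕ λ q → p ≡ suc (suc q)
  prime⇒≡2+ {zero}        pr = ⊥-elim (NonZero.nonZero (prime⇒nonZero pr))
  prime⇒≡2+ {suc zero}    pr = ⊥-elim (ℕ.NonTrivial.nonTrivial (prime⇒nonTrivial pr))
  prime⇒≡2+ {suc (suc q)} pr = q , refl

  prime⇒≥2 : ∀ {p} → Prime p → 2 ≤ p
  prime⇒≥2 pr with prime⇒≡2+ pr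
  ... | q , refl = s≤s (s≤s z≤n)

  prime∣prime⇒≡ : ∀ {p r} → Prime p → Prime r → p ∣ r → p ≡ r
  prime∣prime⇒≡ pp pr h with prime⇒irreducible pr h
  ... | inj₁ refl = ⊥-elim (ℕ.NonTrivial.nonTrivial (prime⇒nonTrivial pp))
  ... | inj₂ e    = e

  prime∤pred : ∀ {p} → Prime p → ¬ p ∣ p ∸ 1
  prime∤pred pr with prime⇒≡2+ pr
  ... | q , refl = λ h → ℕP.<⇒≱ (ℕP.n<1+n (suc q)) (∣⇒≤ h)

  prime∣*∧∤⇒∣ : ∀ {p} a b → Prime p → p ∣ a * b → ¬ p ∣ a → p ∣ b
  prime∣*∧∤⇒∣ a b pr h p∤a with euclidsLemma a b pr h
  ... | inj₁ p∣a = ⊥-elim (p∤a p∣a)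
  ... | inj₂ p∣b = p∣b

  prime∣*∧∤⇒∣ℤ : ∀ {p} a (t : ℤ) → Prime p → (+ p) ℤD.∣ (+ a) ℤ.* t → ¬ p ∣ a → (+ p) ℤD.∣ t
  prime∣*∧∤⇒∣ℤ {p} a t pr h p∤a =
    ∣ᵤ⇒∣ (prime∣*∧∤⇒∣ a ℤ.∣ t ∣ pr (subst (p ∣_) (ℤP.abs-* (+ a) t) (∣⇒∣ᵤ h)) p∤a)

  prime^∣*∧∤⇒∣ : ∀ {p} e {r y} → Prime p → ¬ p ∣ r → p ^ e ∣ r * y → p ^ e ∣ y
  prime^∣*∧∤⇒∣     zero    {y = y} pr p∤r h = divides y (sym (ℕP.*-identityʳ y))
  prime^∣*∧∤⇒∣ {p} (suc e) {r} {y} pr p∤r h with prime^∣*∧∤⇒∣ e pr p∤r (m*n∣⇒n∣ p (p ^ e) h)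
  ... | divides k refl = *-monoˡ-∣ (p ^ e) (prime∣*∧∤⇒∣ r k pr (*-cancelʳ-∣ (p ^ e) h′) p∤r)
    where
    instance _ = ℕP.m^n≢0 p e {{prime⇒nonZero pr}}
    h′ : p * p ^ e ∣ (r * k) * p ^ e
    h′ = subst (p * p ^ e ∣_) (sym (ℕP.*-assoc r k (p ^ e))) h

  prime∣*∧∤⇒*∣ : ∀ {p d X} → Prime p → p ∣ X → d ∣ X → ¬ p ∣ d → p * d ∣ X
  prime∣*∧∤⇒*∣ {p} {d} pr p∣X (divides y refl) p∤d with prime∣*∧∤⇒∣ d y pr (subst (p ∣_) (ℕP.*-comm y d) p∣X) p∤d
  ... | divides z refl = divides z (ℕP.*-assoc z p d)

  p∣pCk : ∀ {p} k → Prime p → 0 < k → k < p → p ∣ p C k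
  p∣pCk {suc p′} (suc k′) pr _ k<p =
    prime∣*∧∤⇒∣ (suc k′) (suc p′ C suc k′) pr (divides (p′ C k′) (trans ([k+1]*[n+1]C[k+1]≡[n+1]*nCk p′ k′) (ℕP.*-comm (suc p′) (p′ C k′))))
      λ p∣k → ℕP.<⇒≱ k<p (∣⇒≤ p∣k)

  n<m^n : ∀ m n → 2 ≤ m → n < m ^ n
  n<m^n m zero    h = s≤s z≤n
  n<m^n m (suc n) h = ℕP.<-≤-trans (ℕP.+-monoʳ-< 1 (n<m^n m n h)) (begin
    1 + m ^ n     ≤⟨ ℕP.+-monoˡ-≤ (m ^ n) (ℕP.m^n>0 m {{ℕ.>-nonZero (ℕP.<-trans (s≤s z≤n) h)}} n) ⟩
    m ^ n + m ^ n ≡⟨ cong (λ z → m ^ n + z) (sym (ℕP.+-identityʳ (m ^ n))) ⟩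
    2 * m ^ n     ≤⟨ ℕP.*-monoˡ-≤ (m ^ n) h ⟩
    m * m ^ n     ∎)
    where open ℕP.≤-Reasoning

  ∃prime∣ : ∀ n → 2 ≤ n → Σ ℕ λ p → Prime p × p ∣ n
  ∃prime∣ (suc zero) (s≤s ())
  ∃prime∣ n@(suc (suc _)) _ with factorise n
  ... | record { factors = [] ; isFactorisation = () }
  ... | record { factors = p ∷ ps ; isFactorisation = e ; factorsPrime = pr ∷ _ } =
    p , pr , divides (product ps) (trans e (ℕP.*-comm p (product ps)))

  ∃prime∤ : ∀ Q → 1 ≤ Q → Σ ℕ λ p → Prime p × ¬ p ∣ Q
  ∃prime∤ Q 1≤Q with ∃prime∣ (Q + 1) (ℕP.+-monoˡ-≤ 1 1≤Q)
  ... | p , pr , p∣Q+1 = p , pr , λ p∣Q → ℕP.<⇒≱ (prime⇒≥2 pr) (∣⇒≤ (∣m+n∣m⇒∣n p∣Q+1 p∣Q))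

  m∣n! : ∀ {m n} → 1 ≤ m → m ≤ n → m ∣ n !
  m∣n! {suc m} _ m≤n = ∣-trans (divides (m !) (ℕP.*-comm (suc m) (m !))) (m≤n⇒m!∣n! m≤n)

  prime^*∤-decomposition : ∀ {p} → Prime p → ∀ m → 0 < m → Σ ℕ λ e → Σ ℕ λ r → m ≡ p ^ e * r × ¬ p ∣ r
  prime^*∤-decomposition {p} pr = <-rec _ go
    where
    go : ∀ m → (∀ {k} → k < m → 0 < k → Σ ℕ λ e → Σ ℕ λ r → k ≡ p ^ e * r × ¬ p ∣ r) →
         0 < m → Σ ℕ λ e → Σ ℕ λ r → m ≡ p ^ e * r × ¬ p ∣ r
    go m rec 0<m with p ∣? m
    ... | no p∤m = 0 , m , sym (ℕP.+-identityʳ m) , p∤m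
    ... | yes (divides k refl) with rec (ℕP.m<m*n k p {{ℕ.>-nonZero 0<k}} (prime⇒≥2 pr)) 0<k
      where
      0<k : 0 < k
      0<k = ℕP.n≢0⇒n>0 λ { refl → ℕP.<-irrefl refl 0<m }
    ... | e , r , refl , p∤r = suc e , r , lemma (p ^ e) r p , p∤r
      where
      lemma : ∀ x r p → x * r * p ≡ p * x * r
      lemma x r p = trans (ℕP.*-comm (x * r) p) (sym (ℕP.*-assoc p x r))

  prime^∣⇒∣ : ∀ m → 0 < m → ∀ X → (∀ p e → Prime p → p ^ suc e ∣ m → p ^ suc e ∣ X) → m ∣ X
  prime^∣⇒∣ m 0<m X = <-rec _ go m 0<m
    where
    go : ∀ m → (∀ {k} → k < m → 0 < k → (∀ p e → Prime p → p ^ suc e ∣ k → p ^ suc e ∣ X) → k ∣ X) →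
         0 < m → (∀ p e → Prime p → p ^ suc e ∣ m → p ^ suc e ∣ X) → m ∣ X
    go (suc zero) _ _ _ = divides X (sym (ℕP.*-identityʳ X))
    go m@(suc (suc _)) rec 0<m h with ∃prime∣ m (s≤s (s≤s z≤n))
    ... | p , pr , p∣m with prime^*∤-decomposition pr m 0<m
    ... | zero  , r , m≡r , p∤r = ⊥-elim (p∤r (subst (p ∣_) (trans m≡r (ℕP.+-identityʳ r)) p∣m))
    ... | suc e , r , m≡p^e*r , p∤r =
      subst (_∣ X) (sym m≡p^e*r) (subst (p ^ suc e * r ∣_) (sym X≡y*r) (*-monoˡ-∣ r p^e∣y))
      where
      instance _ = ℕP.m^n≢0 p (suc e) {{prime⇒nonZero pr}}
      0<r : 0 < r
      0<r = ℕP.n≢0⇒n>0 λ { refl → ℕP.0≢1+n (sym (trans m≡p^e*r (ℕP.*-zeroʳ (p ^ suc e)))) }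
      r∣m : r ∣ m
      r∣m = divides (p ^ suc e) m≡p^e*r
      r<m : r < m
      r<m = subst (r <_) (trans (ℕP.*-comm r (p ^ suc e)) (sym m≡p^e*r))
              (ℕP.m<m*n r (p ^ suc e) {{ℕ.>-nonZero 0<r}} (ℕP.<-≤-trans (prime⇒≥2 pr) (ℕP.m≤m*n p (p ^ e) {{ℕP.m^n≢0 p e {{prime⇒nonZero pr}}}})))
      r∣X : r ∣ X
      r∣X = rec r<m 0<r (λ q f pr′ d → h q f pr′ (∣-trans d r∣m))
      y : ℕ
      y = quotient r∣X
      X≡y*r : X ≡ y * r
      X≡y*r = m∣n⇒n≡quotient*m r∣X
      p^e∣y : p ^ suc e ∣ y
      p^e∣y = prime^∣*∧∤⇒∣ (suc e) pr p∤r (subst (p ^ suc e ∣_) (trans X≡y*r (ℕP.*-comm y r))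
                (h p e pr (divides r (trans m≡p^e*r (ℕP.*-comm (p ^ suc e) r)))))

module PowerSum where

  open import Data.Integer using (+_; _+_; _*_; _-_; _^_)
  open import Data.Nat using (_<_; z≤n; s≤s)
  open import Data.Nat.Divisibility using (∣⇒≤)
  import Data.Nat.Divisibility as ℕD
  import Data.Nat.DivMod as ℕDM
  open import Data.Nat.Primality using (Prime)
  open import Data.Nat.Combinatorics using (_C_; nCn≡1)
  open import Data.Nat.Induction using (<-rec)
  open import Data.Integer.Divisibility.Signed using (_∣_; ∣-refl; ∣m⇒∣m*n; ∣ᵤ⇒∣)
  open import Data.Empty using (⊥-elim)
  open import Relation.Nullary using (¬_)
  open import Data.Integer.Tactic.RingSolver using (solve-∀)
  open Congruence
  open Sum
  open Binomial
  open Primes using (p∣pCk; prime∣*∧∤⇒∣ℤ)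

  -- The sum starts at 0 ^ j, which is 1 when j = 0.
  powerSum : ℕ → ℕ → ℤ
  powerSum n j = ∑[< n ] (λ r → (+ r) ^ j)

  pos-suc : ∀ r → + suc r ≡ + r + 1ℤ
  pos-suc r = trans (cong +_ (ℕP.+-comm 1 r)) (ℤP.pos-+ r 1)

  ∑binomial*powerSum≡n^k : ∀ n k → ∑[< suc k ] (λ j → + (suc k C j) * powerSum n j) ≡ (+ n) ^ suc k
  ∑binomial*powerSum≡n^k n k = begin
    ∑[< suc k ] (λ j → + (suc k C j) * powerSum n j)
      ≡⟨ ∑-cong (suc k) (λ j _ → sym (∑-distribˡ-* n (+ (suc k C j)) (λ r → (+ r) ^ j))) ⟩
    ∑[< suc k ] (λ j → ∑[< n ] (λ r → binomialTerm (suc k) (+ r) j))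
      ≡⟨ sym (∑-comm n (suc k) (λ r j → binomialTerm (suc k) (+ r) j)) ⟩
    A
      ≡⟨ telescope A (powerSum n (suc k)) ((+ n) ^ suc k) (trans shifted (cong (λ z → 0ℤ + z) expanded)) ⟩
    (+ n) ^ suc k ∎
    where
    open ≡-Reasoning
    A : ℤ
    A = ∑[< n ] (λ r → ∑[< suc k ] (binomialTerm (suc k) (+ r)))
    expanded : ∑[< n ] (λ r → (+ suc r) ^ suc k) ≡ A + powerSum n (suc k)
    expanded = trans (∑-cong n (λ r _ → trans (cong (_^ suc k) (pos-suc r))
                 (trans (binomial-theorem (suc k) (+ r)) (cong (λ z → ∑[< suc k ] (binomialTerm (suc k) (+ r)) + z) (top r)))))
                 (∑-distrib-+ n _ _)
      where
      top : ∀ r → binomialTerm (suc k) (+ r) (suc k) ≡ (+ r) ^ suc k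
      top r rewrite nCn≡1 (suc k) = ℤP.*-identityˡ _
    shifted : powerSum n (suc k) + (+ n) ^ suc k ≡ 0ℤ + ∑[< n ] (λ r → (+ suc r) ^ suc k)
    shifted = ∑-suc n (λ r → (+ r) ^ suc k)
    telescope : ∀ a t b → t + b ≡ 0ℤ + (a + t) → a ≡ b
    telescope a t b h = begin
      a                ≡⟨ lemma₁ a t ⟩
      0ℤ + (a + t) - t ≡⟨ cong (_- t) (sym h) ⟩
      t + b - t        ≡⟨ lemma₂ t b ⟩
      b                ∎
      where
      lemma₁ : ∀ a t → a ≡ 0ℤ + (a + t) - t
      lemma₁ = solve-∀
      lemma₂ : ∀ t b → t + b - t ≡ b
      lemma₂ = solve-∀

  module ModPrime (q : ℕ) (pr : Prime (suc (suc q))) where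

    private
      p p-1 : ℕ
      p = suc (suc q)
      p-1 = suc q

    infix 4 _≡ₚ_
    _≡ₚ_ : ℤ → ℤ → Set
    a ≡ₚ b = a ≡ b mod + p

    freshmans-dream : ∀ x → (x + 1ℤ) ^ p ≡ₚ x ^ p + 1ℤ
    freshmans-dream x =
      ≡mod-trans (≡⇒≡mod (binomial-theorem p x)) (≡mod-trans expand (≡⇒≡mod (lemma (x ^ p))))
      where
      middle : ∑[< p-1 ] (λ j → binomialTerm p x (suc j)) ≡ₚ 0ℤ
      middle = ≡mod-trans
        (∑-cong-mod p-1 (λ j j<p-1 → ∣⇒≡mod0 (∣m⇒∣m*n (x ^ suc j) (∣ᵤ⇒∣ {k = + p} {i = + (p C suc j)} (p∣pCk (suc j) pr (s≤s z≤n) (s≤s j<p-1))))))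
        (≡⇒≡mod (trans (∑-const p-1 0ℤ) (ℤP.*-zeroʳ (+ p-1))))
      expand : ∑[< suc p ] (binomialTerm p x) ≡ₚ 1ℤ + 0ℤ + 1ℤ * x ^ p
      expand = +-cong-mod (≡mod-trans (≡⇒≡mod (∑-suc p-1 (binomialTerm p x))) (+-cong-mod (≡mod-refl {a = 1ℤ}) middle))
                          (≡⇒≡mod (cong (λ c → + c * x ^ p) (nCn≡1 p)))
      lemma : ∀ y → 1ℤ + 0ℤ + 1ℤ * y ≡ y + 1ℤ
      lemma = solve-∀

    fermat : ∀ a → (+ a) ^ p ≡ₚ + a
    fermat zero    = ≡mod-refl
    fermat (suc a) = ≡mod-trans (≡⇒≡mod (cong (_^ p) (pos-suc a)))
      (≡mod-trans (freshmans-dream (+ a)) (≡mod-trans (+-cong-mod (fermat a) ≡mod-refl) (≡⇒≡mod (sym (pos-suc a)))))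

    fermat-unit : ∀ r → 0 < r → r < p → (+ r) ^ p-1 ≡ₚ 1ℤ
    fermat-unit r 0<r r<p = from-∣ (prime∣*∧∤⇒∣ℤ r _ pr (subst (+ p ∣_) (lemma (+ r) ((+ r) ^ p-1)) (to-∣ (fermat r)))
      λ p∣r → ℕP.<⇒≱ r<p (∣⇒≤ {{ℕ.>-nonZero 0<r}} p∣r))
      where
      lemma : ∀ x y → x * y - x ≡ x * (y - 1ℤ)
      lemma = solve-∀

    ^-periodic : ∀ r m → (+ r) ^ (suc m ℕ.+ p-1) ≡ₚ (+ r) ^ suc m
    ^-periodic r m = ≡mod-trans (≡⇒≡mod (trans (cong ((+ r) ^_) (sym (ℕP.+-suc m p-1))) (ℤP.^-distribˡ-+-* (+ r) m p)))
      (≡mod-trans (*-cong-mod (≡mod-refl {a = (+ r) ^ m}) (fermat r)) (≡⇒≡mod (ℤP.*-comm ((+ r) ^ m) (+ r))))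

    powerSum-periodic : ∀ m d → powerSum p (suc m ℕ.+ d ℕ.* p-1) ≡ₚ powerSum p (suc m)
    powerSum-periodic m zero    = ≡⇒≡mod (cong (powerSum p) (ℕP.+-identityʳ (suc m)))
    powerSum-periodic m (suc d) = ≡mod-trans (≡⇒≡mod (cong (powerSum p) (lemma m d)))
      (≡mod-trans (∑-cong-mod p (λ r _ → ^-periodic r (m ℕ.+ d ℕ.* p-1))) (powerSum-periodic m d))
      where
      lemma : ∀ m d → suc m ℕ.+ (p-1 ℕ.+ d ℕ.* p-1) ≡ suc (m ℕ.+ d ℕ.* p-1) ℕ.+ p-1
      lemma m d = cong suc (rearrange m d)
        where
        rearrange : ∀ m d → m ℕ.+ (p-1 ℕ.+ d ℕ.* p-1) ≡ m ℕ.+ d ℕ.* p-1 ℕ.+ p-1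
        rearrange m d = trans (sym (ℕP.+-assoc m p-1 _)) (trans (cong (ℕ._+ d ℕ.* p-1) (ℕP.+-comm m p-1))
                         (trans (ℕP.+-assoc p-1 m _) (ℕP.+-comm p-1 _)))

    powerSum[p-1]≡-1 : powerSum p p-1 + 1ℤ ≡ₚ 0ℤ
    powerSum[p-1]≡-1 = ≡mod-trans
      (+-cong-mod (≡mod-trans (≡⇒≡mod (∑-suc p-1 (λ r → (+ r) ^ p-1)))
                    (+-cong-mod (≡⇒≡mod {a = (+ 0) ^ p-1} {b = 0ℤ} refl)
                      (≡mod-trans (∑-cong-mod p-1 (λ r r<p-1 → fermat-unit (suc r) (s≤s z≤n) (s≤s r<p-1)))
                                  (≡⇒≡mod (trans (∑-const p-1 1ℤ) (ℤP.*-identityʳ (+ p-1)))))))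
                  (≡mod-refl {a = 1ℤ}))
      (≡mod-trans (≡⇒≡mod (trans (ℤP.+-identityˡ (+ p-1 + 1ℤ)) (sym (pos-suc p-1)))) (∣⇒≡mod0 ∣-refl))

    powerSum≡0-below : ∀ j → j < p-1 → powerSum p j ≡ₚ 0ℤ
    powerSum≡0-below = <-rec _ go
      where
      go : ∀ j → (∀ {i} → i < j → i < p-1 → powerSum p i ≡ₚ 0ℤ) → j < p-1 → powerSum p j ≡ₚ 0ℤ
      go j rec j<p-1 = ∣⇒≡mod0 (prime∣*∧∤⇒∣ℤ (suc j) (powerSum p j) pr (≡mod0⇒∣ [j+1]*Tⱼ≡0)
                         λ p∣j+1 → ℕP.<⇒≱ (s≤s j<p-1) (∣⇒≤ p∣j+1))
        where
        c : ℕ → ℤ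
        c i = + (suc j C i)
        lower≡0 : ∑[< j ] (λ i → c i * powerSum p i) ≡ₚ 0ℤ
        lower≡0 = ≡mod-trans
          (∑-cong-mod j (λ i i<j → ≡mod-trans (*-cong-mod (≡mod-refl {a = c i}) (rec i<j (ℕP.<-trans i<j j<p-1)))
                                               (≡⇒≡mod (ℤP.*-zeroʳ (c i)))))
          (≡⇒≡mod (trans (∑-const j 0ℤ) (ℤP.*-zeroʳ (+ j))))
        all≡0 : ∑[< j ] (λ i → c i * powerSum p i) + c j * powerSum p j ≡ₚ 0ℤ
        all≡0 = subst (_≡ₚ 0ℤ) (sym (∑binomial*powerSum≡n^k p j)) (∣⇒≡mod0 (∣m⇒∣m*n ((+ p) ^ j) ∣-refl))
        [j+1]*Tⱼ≡0 : + suc j * powerSum p j ≡ₚ 0ℤ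
        [j+1]*Tⱼ≡0 = ≡mod-trans
          (≡mod-trans (≡⇒≡mod (cong (λ z → + z * powerSum p j) (sym (Binomial.[n+1]Cn≡n+1 j))))
            (≡mod-trans (≡⇒≡mod (sym (ℤP.+-identityˡ _))) (+-cong-mod (≡mod-sym lower≡0) ≡mod-refl)))
          all≡0

    powerSum≡-1 : ∀ m → p-1 ℕD.∣ suc m → powerSum p (suc m) + 1ℤ ≡ₚ 0ℤ
    powerSum≡-1 m h with suc m ℕDM./ p-1 | ℕDM.m≡m%n+[m/n]*n (suc m) p-1 | ℕD.n∣m⇒m%n≡0 (suc m) p-1 h
    ... | zero  | e | r≡0 rewrite r≡0 = ⊥-elim (ℕP.0≢1+n (sym e))
    ... | suc d | e | r≡0 rewrite r≡0 =
      subst (λ z → powerSum p z + 1ℤ ≡ₚ 0ℤ) (sym e) (≡mod-trans (+-cong-mod (powerSum-periodic q d) (≡mod-refl {a = 1ℤ})) powerSum[p-1]≡-1)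

    powerSum≡0 : ∀ m → ¬ p-1 ℕD.∣ suc m → powerSum p (suc m) ≡ₚ 0ℤ
    powerSum≡0 m h with suc m ℕDM.% p-1 | ℕDM.m≡m%n+[m/n]*n (suc m) p-1 | ℕDM.m%n<n (suc m) p-1 | ℕD.m%n≡0⇒n∣m (suc m) p-1
    ... | zero  | e | _   | f = ⊥-elim (h (f refl))
    ... | suc r | e | r<p-1 | _ = subst (λ z → powerSum p z ≡ₚ 0ℤ) (sym e)
      (≡mod-trans (powerSum-periodic r (suc m ℕDM./ p-1)) (powerSum≡0-below (suc r) r<p-1))

module SelfPowerSum where

  open import Data.Integer using (+_; _+_; _*_; _-_)
  open import Data.Nat using (_<_; _^_; _/_; _%_)
  import Data.Nat.Divisibility as ℕD
  import Data.Nat.DivMod as ℕDM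
  open import Data.Nat.Primality using (Prime)
  open import Data.Integer.Divisibility.Signed using (_∣_; ∣-refl; ∣m⇒∣m*n)
  open import Data.Product using (Σ; _,_)
  open import Relation.Nullary using (¬_)
  open import Data.Integer.Tactic.RingSolver using (solve-∀)
  open Congruence
  open Sum
  open PowerSum

  *-pres-∣ℤ : ∀ {a b c e : ℤ} → a ∣ b → c ∣ e → a * c ∣ b * e
  *-pres-∣ℤ {a} {b} {c} {e} (divides q₁ refl) (divides q₂ refl) = divides (q₁ * q₂) (lemma q₁ a q₂ c)
    where
    lemma : ∀ q₁ a q₂ c → q₁ * a * (q₂ * c) ≡ q₁ * q₂ * (a * c)
    lemma = solve-∀

  geometric : ℤ → ℤ → ℕ → ℤ
  geometric x y zero    = 0ℤ
  geometric x y (suc n) = x ℤ.^ n + y * geometric x y n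

  ^-difference : ∀ x y n → x ℤ.^ n - y ℤ.^ n ≡ (x - y) * geometric x y n
  ^-difference x y zero    = trans (ℤP.+-inverseʳ 1ℤ) (sym (ℤP.*-zeroʳ (x - y)))
  ^-difference x y (suc n) = begin
    x * x ℤ.^ n - y * y ℤ.^ n                       ≡⟨ lemma₁ x y (x ℤ.^ n) (y ℤ.^ n) ⟩
    (x - y) * x ℤ.^ n + y * (x ℤ.^ n - y ℤ.^ n)     ≡⟨ cong (λ z → (x - y) * x ℤ.^ n + y * z) (^-difference x y n) ⟩
    (x - y) * x ℤ.^ n + y * ((x - y) * geometric x y n) ≡⟨ lemma₂ x y (x ℤ.^ n) (geometric x y n) ⟩
    (x - y) * (x ℤ.^ n + y * geometric x y n)        ∎
    where
    open ≡-Reasoning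
    lemma₁ : ∀ x y a b → x * a - y * b ≡ (x - y) * a + y * (a - b)
    lemma₁ = solve-∀
    lemma₂ : ∀ x y a g → (x - y) * a + y * ((x - y) * g) ≡ (x - y) * (a + y * g)
    lemma₂ = solve-∀

  geometric-≡mod : ∀ {d x y} → x ≡ y mod d → ∀ n → geometric x y (suc n) ≡ + suc n * y ℤ.^ n mod d
  geometric-≡mod {y = y} h zero = ≡⇒≡mod (cong (λ z → 1ℤ + z) (ℤP.*-zeroʳ y))
  geometric-≡mod {d} {x} {y} h (suc n) =
    ≡mod-trans (+-cong-mod (^-cong-mod (suc n) h) (*-cong-mod (≡mod-refl {a = y}) (geometric-≡mod h n)))
      (≡⇒≡mod (trans (lemma y (y ℤ.^ n) (+ suc n)) (cong (_* (y * y ℤ.^ n)) (sym (pos-suc (suc n))))))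
    where
    lemma : ∀ y a s → y * a + y * (s * a) ≡ (s + 1ℤ) * (y * a)
    lemma = solve-∀

  pos-^ : ∀ a n → + (a ℕ.^ n) ≡ (+ a) ℤ.^ n
  pos-^ a zero    = refl
  pos-^ a (suc n) = trans (ℤP.pos-* a (a ℕ.^ n)) (cong (+ a *_) (pos-^ a n))

  S≡∑ : ∀ a b → + S a b ≡ ∑[< b ] (λ i → (+ suc i) ℤ.^ a)
  S≡∑ a zero    = refl
  S≡∑ a (suc b) = trans (ℤP.pos-+ (S a b) _) (cong₂ _+_ (S≡∑ a b) (pos-^ (suc b) a))

  module ModPrimePower (q : ℕ) (pr : Prime (suc (suc q))) where

    private
      p p-1 : ℕ
      p = suc (suc q)
      p-1 = suc q

    +p^ : ℕ → ℤ
    +p^ e = + (p ^ e)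

    +p^-suc : ∀ e → + (p ^ e) * + p ≡ +p^ (suc e)
    +p^-suc e = trans (sym (ℤP.pos-* (p ^ e) p)) (cong +_ (ℕP.*-comm (p ^ e) p))

    -- p ∣ geometric x y p, because each of its p terms is ≡ y ^ (p - 1)
    ^p-lift : ∀ i {x y} → x ≡ y mod +p^ (suc i) → x ℤ.^ p ≡ y ℤ.^ p mod +p^ (suc (suc i))
    ^p-lift i {x} {y} h = from-∣ (subst₂ _∣_ (+p^-suc (suc i)) (sym (^-difference x y p)) (*-pres-∣ℤ (to-∣ h) p∣geometric))
      where
      x≡y : x ≡ y mod + p
      x≡y = ≡mod-weaken (divides (+ (p ^ i)) (trans (ℤP.pos-* p (p ^ i)) (ℤP.*-comm (+ p) (+ (p ^ i))))) h
      p∣geometric : + p ∣ geometric x y p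
      p∣geometric = ≡mod0⇒∣ (≡mod-trans (geometric-≡mod x≡y p-1) (∣⇒≡mod0 (∣m⇒∣m*n (y ℤ.^ p-1) ∣-refl)))

    ^p^e-lift : ∀ e {x y} → x ≡ y mod + p → x ℤ.^ (p ^ e) ≡ y ℤ.^ (p ^ e) mod +p^ (suc e)
    ^p^e-lift zero {x} {y} h = subst (λ a → x ℤ.^ 1 ≡ y ℤ.^ 1 mod a) (cong +_ (sym (ℕP.*-identityʳ p)))
      (subst₂ (λ u v → u ≡ v mod + p) (sym (ℤP.^-identityʳ x)) (sym (ℤP.^-identityʳ y)) h)
    ^p^e-lift (suc e) {x} {y} h = subst₂ (λ u v → u ≡ v mod +p^ (suc (suc e))) (^-^p x) (^-^p y) (^p-lift e (^p^e-lift e h))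
      where
      ^-^p : ∀ x → (x ℤ.^ (p ^ e)) ℤ.^ p ≡ x ℤ.^ (p ^ suc e)
      ^-^p x = trans (ℤP.^-*-assoc x (p ^ e) p) (cong (x ℤ.^_) (ℕP.*-comm (p ^ e) p))

    ≡%p : ∀ k → + k ≡ + (k % p) mod + p
    ≡%p k = from-∣ (divides (+ (k / p)) (begin
      + k - + (k % p)                     ≡⟨ cong (λ z → + z - + (k % p)) (ℕDM.m≡m%n+[m/n]*n k p) ⟩
      + (k % p ℕ.+ k / p ℕ.* p) - + (k % p) ≡⟨ cong (_- + (k % p)) (ℤP.pos-+ (k % p) _) ⟩
      + (k % p) + + (k / p ℕ.* p) - + (k % p) ≡⟨ lemma (+ (k % p)) (+ (k / p ℕ.* p)) ⟩
      + (k / p ℕ.* p)                     ≡⟨ ℤP.pos-* (k / p) p ⟩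
      + (k / p) * + p                     ∎))
      where
      open ≡-Reasoning
      lemma : ∀ a b → a + b - a ≡ b
      lemma = solve-∀

    ^≡^% : ∀ e m k → p ^ e ℕD.∣ m → (+ k) ℤ.^ m ≡ (+ (k % p)) ℤ.^ m mod +p^ (suc e)
    ^≡^% e m k (ℕD.divides s refl) =
      subst₂ (λ u v → u ≡ v mod +p^ (suc e)) (ℤP.^-*-assoc (+ k) s _) (ℤP.^-*-assoc (+ (k % p)) s _)
        (^p^e-lift e (^-cong-mod s (≡%p k)))

    ∑^%≡*powerSum : ∀ m t → ∑[< t ℕ.* p ] (λ i → (+ (i % p)) ℤ.^ m) ≡ + t * powerSum p m
    ∑^%≡*powerSum m zero    = refl
    ∑^%≡*powerSum m (suc t) = begin
      ∑[< p ℕ.+ t ℕ.* p ] f                         ≡⟨ cong (λ n → ∑[< n ] f) (ℕP.+-comm p (t ℕ.* p)) ⟩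
      ∑[< t ℕ.* p ℕ.+ p ] f                         ≡⟨ ∑-+ (t ℕ.* p) p f ⟩
      ∑[< t ℕ.* p ] f + ∑[< p ] (λ i → f (t ℕ.* p ℕ.+ i))
        ≡⟨ cong₂ _+_ (∑^%≡*powerSum m t) (∑-cong p (λ i i<p → cong (λ z → (+ z) ℤ.^ m) (block-residue i i<p))) ⟩
      + t * powerSum p m + powerSum p m             ≡⟨ lemma (+ t) (powerSum p m) ⟩
      (+ t + 1ℤ) * powerSum p m                     ≡⟨ cong (_* powerSum p m) (sym (pos-suc t)) ⟩
      + suc t * powerSum p m                        ∎
      where
      open ≡-Reasoning
      f : ℕ → ℤ
      f i = (+ (i % p)) ℤ.^ m
      block-residue : ∀ i → i < p → (t ℕ.* p ℕ.+ i) % p ≡ i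
      block-residue i i<p = trans (cong (_% p) (ℕP.+-comm (t ℕ.* p) i)) (trans (ℕDM.[m+kn]%n≡m%n i t p) (ℕDM.m<n⇒m%n≡m i<p))
      lemma : ∀ a b → a * b + b ≡ (a + 1ℤ) * b
      lemma = solve-∀

    -- Reducing each base mod p splits S M M into M / p full blocks of residues.
    S≡[M/p]*powerSum : ∀ e M → p ^ suc e ℕD.∣ suc M → + S (suc M) (suc M) ≡ + (suc M / p) * powerSum p (suc M) mod +p^ (suc e)
    S≡[M/p]*powerSum e m h = ≡mod-trans (≡⇒≡mod (trans (S≡∑ M M) shift))
        (≡mod-trans (+-cong-mod (∑-cong-mod M (λ i _ → ^≡^% e M i p^e∣M)) (≡mod-trans (^≡^% e M M p^e∣M) (≡⇒≡mod M^M≡0)))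
        (≡⇒≡mod (trans (ℤP.+-identityʳ _) (trans (cong (λ n → ∑[< n ] (λ i → (+ (i % p)) ℤ.^ M)) M≡M/p*p) (∑^%≡*powerSum M (M / p))))))
      where
      M = suc m
      p^e∣M : p ^ e ℕD.∣ M
      p^e∣M = ℕD.∣-trans (ℕD.divides p refl) h
      p∣M : p ℕD.∣ M
      p∣M = ℕD.∣-trans (ℕD.divides (p ^ e) (ℕP.*-comm p (p ^ e))) h
      M≡M/p*p : M ≡ (M / p) ℕ.* p
      M≡M/p*p = sym (ℕDM.m/n*n≡m p∣M)
      M^M≡0 : (+ (M % p)) ℤ.^ M ≡ 0ℤ
      M^M≡0 rewrite ℕD.n∣m⇒m%n≡0 M p p∣M = ℤP.*-zeroˡ ((+ 0) ℤ.^ m)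
      shift : ∑[< M ] (λ i → (+ suc i) ℤ.^ M) ≡ ∑[< M ] (λ i → (+ i) ℤ.^ M) + (+ M) ℤ.^ M
      shift = trans (sym (ℤP.+-identityˡ _)) (trans (cong (_+ ∑[< M ] (λ i → (+ suc i) ℤ.^ M)) (sym (ℤP.*-zeroˡ ((+ 0) ℤ.^ m))))
                (sym (∑-suc M (λ i → (+ i) ℤ.^ M))))

    M/p≡k*p^e : ∀ e m → p ^ suc e ℕD.∣ suc m → Σ ℕ λ k → suc m / p ≡ k ℕ.* p ^ e
    M/p≡k*p^e e m (ℕD.divides k eq) = k , trans (cong (_/ p) (trans eq (lemma k (p ^ e)))) (ℕDM.m*n/n≡m (k ℕ.* p ^ e) p)
      where
      lemma : ∀ k x → k ℕ.* (p ℕ.* x) ≡ k ℕ.* x ℕ.* p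
      lemma k x = trans (cong (k ℕ.*_) (ℕP.*-comm p x)) (sym (ℕP.*-assoc k x p))

    *p^e-lift-0 : ∀ e k a → a ≡ 0ℤ mod + p → + (k ℕ.* p ^ e) * a ≡ 0ℤ mod +p^ (suc e)
    *p^e-lift-0 e k a h = subst₂ (λ u d → u ≡ 0ℤ mod d) reassoc (+p^-suc e)
      (≡mod-trans (*-cong-mod (≡mod-refl {a = + k}) (*-scale-mod (+ (p ^ e)) h)) (≡⇒≡mod (lemma (+ k) (+ (p ^ e)))))
      where
      lemma : ∀ x y → x * (y * 0ℤ) ≡ 0ℤ
      lemma = solve-∀
      reassoc : + k * (+ (p ^ e) * a) ≡ + (k ℕ.* p ^ e) * a
      reassoc = trans (sym (ℤP.*-assoc (+ k) _ a)) (cong (_* a) (sym (ℤP.pos-* k (p ^ e))))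

    S≡0 : ∀ e m → p ^ suc e ℕD.∣ suc m → ¬ p-1 ℕD.∣ suc m → + S (suc m) (suc m) ≡ 0ℤ mod +p^ (suc e)
    S≡0 e m h p-1∤M with M/p≡k*p^e e m h
    ... | k , eq = ≡mod-trans (S≡[M/p]*powerSum e m h)
      (subst (λ z → + z * powerSum p (suc m) ≡ 0ℤ mod +p^ (suc e)) (sym eq)
        (*p^e-lift-0 e k _ (ModPrime.powerSum≡0 q pr m p-1∤M)))

    S+M/p≡0 : ∀ e m → p ^ suc e ℕD.∣ suc m → p-1 ℕD.∣ suc m → + S (suc m) (suc m) + + (suc m / p) ≡ 0ℤ mod +p^ (suc e)
    S+M/p≡0 e m h p-1∣M with M/p≡k*p^e e m h
    ... | k , eq = ≡mod-trans (+-cong-mod (S≡[M/p]*powerSum e m h) (≡mod-refl {a = + (suc m / p)}))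
      (≡mod-trans (≡⇒≡mod (lemma (+ (suc m / p)) (powerSum p (suc m))))
        (subst (λ z → + z * (powerSum p (suc m) + 1ℤ) ≡ 0ℤ mod +p^ (suc e)) (sym eq)
          (*p^e-lift-0 e k _ (ModPrime.powerSum≡-1 q pr m p-1∣M))))
      where
      lemma : ∀ a t → a * t + a ≡ a * (t + 1ℤ)
      lemma = solve-∀

module Pseudoperfect where

  open import Data.Nat using (_+_; _*_; _≤_; _<_; _/_; z≤n; s≤s)
  open import Data.Nat.Divisibility using (_∣_; divides; _∣?_; ∣-trans; ∣⇒≤; quotient; m∣n⇒n≡quotient*m; ∣m∣n⇒∣m+n; ∣m+n∣m⇒∣n; n∣m*n; ∣1⇒≡1)
  import Data.Nat.DivMod as ℕDM
  open import Data.Nat.Primality using (Prime; prime?; euclidsLemma; prime⇒nonZero)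
  open import Relation.Binary.Definitions using (tri<; tri≈; tri>)
  open import Data.Sum using (inj₁; inj₂)
  open import Data.Product using (Σ; _×_; _,_)
  open import Data.Empty using (⊥-elim)
  open import Relation.Nullary using (¬_; yes; no)
  open import Relation.Nullary.Decidable using (_×-dec_)
  open import Data.Nat.Tactic.RingSolver using (solve-∀)
  open Primes using (prime⇒≥2; prime∣prime⇒≡)

  module _ (Q p : ℕ) (pr : Prime p) (p∣Q : p ∣ Q) where

    private instance
      p≢0 : ℕ.NonZero p
      p≢0 = prime⇒nonZero pr

    p∣Q/r : ∀ r → Prime r → r ∣ Q → r ≢ p → .{{_ : ℕ.NonZero r}} → p ∣ Q / r
    p∣Q/r r rp r∣Q r≢p with euclidsLemma (Q / r) r pr (subst (p ∣_) (sym (ℕDM.m/n*n≡m r∣Q)) p∣Q)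
    ... | inj₁ p∣Q/r = p∣Q/r
    ... | inj₂ p∣r   = ⊥-elim (r≢p (sym (prime∣prime⇒≡ pr rp p∣r)))

    -- Every term Q / r with r ≠ p is a multiple of p; the term Q / p enters once k reaches p.
    primeQuotSum-mod-p : ∀ k → (k < p → p ∣ primeQuotSum Q k) × (p ≤ k → Σ ℕ λ t → primeQuotSum Q k ≡ Q / p + t * p)
    primeQuotSum-mod-p zero = (λ _ → divides 0 refl) , (λ p≤0 → ⊥-elim (ℕP.<⇒≱ (ℕP.≤-trans (s≤s z≤n) (prime⇒≥2 pr)) p≤0))
    primeQuotSum-mod-p (suc k) with primeQuotSum-mod-p k | ℕP.<-cmp (suc k) p
    primeQuotSum-mod-p (suc k) | below , _ | tri< k<p _ _ with prime? (suc k) ×-dec (suc k ∣? Q)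
    ... | yes (rp , r∣Q) = (λ _ → ∣m∣n⇒∣m+n (p∣Q/r (suc k) rp r∣Q (λ e → ℕP.<-irrefl e k<p)) (below (ℕP.<-trans (ℕP.n<1+n k) k<p)))
                         , (λ p≤k → ⊥-elim (ℕP.<⇒≱ k<p p≤k))
    ... | no _           = (λ _ → below (ℕP.<-trans (ℕP.n<1+n k) k<p)) , (λ p≤k → ⊥-elim (ℕP.<⇒≱ k<p p≤k))
    primeQuotSum-mod-p (suc k) | below , _ | tri≈ _ refl _ with prime? (suc k) ×-dec (suc k ∣? Q)
    ... | yes _ = (λ k<k → ⊥-elim (ℕP.<-irrefl refl k<k))
                , (λ _ → quotient (below (ℕP.n<1+n k)) , cong (λ z → Q / suc k + z) (m∣n⇒n≡quotient*m (below (ℕP.n<1+n k))))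
    ... | no ¬p = ⊥-elim (¬p (pr , p∣Q))
    primeQuotSum-mod-p (suc k) | _ , above | tri> _ _ p<k with prime? (suc k) ×-dec (suc k ∣? Q) | above (ℕP.≤-pred p<k)
    ... | yes (rp , r∣Q) | t , e = (λ k<p → ⊥-elim (ℕP.<⇒≱ p<k (ℕP.<⇒≤ k<p))) , λ _ → quotient p∣Q/k ℕ.+ t , lemma
      where
      p∣Q/k : p ∣ Q / suc k
      p∣Q/k = p∣Q/r (suc k) rp r∣Q (λ e → ℕP.<-irrefl (sym e) p<k)
      lemma : Q / suc k + primeQuotSum Q k ≡ Q / p + (quotient p∣Q/k + t) * p
      lemma = trans (cong₂ _+_ (m∣n⇒n≡quotient*m p∣Q/k) e) (rearrange (quotient p∣Q/k) p (Q / p) t)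
        where
        rearrange : ∀ u p a t → u * p + (a + t * p) ≡ a + (u + t) * p
        rearrange = solve-∀
    ... | no _ | t , e = (λ k<p → ⊥-elim (ℕP.<⇒≱ p<k (ℕP.<⇒≤ k<p))) , λ _ → t , e

    module _ (Q≥1 : 1 ≤ Q) (Q∣sum+1 : Q ∣ primeDivSum Q + 1) where

      p∣Q/p+1 : p ∣ Q / p + 1
      p∣Q/p+1 with primeQuotSum-mod-p Q
      ... | _ , above with above (∣⇒≤ {{ℕ.>-nonZero Q≥1}} p∣Q)
      ... | t , e = ∣m+n∣m⇒∣n (subst (p ∣_) e′ (∣-trans p∣Q Q∣sum+1)) (n∣m*n t)
        where
        e′ : primeDivSum Q + 1 ≡ t * p + (Q / p + 1)
        e′ = trans (cong (_+ 1) e) (trans (cong (_+ 1) (ℕP.+-comm (Q / p) (t * p))) (ℕP.+-assoc (t * p) (Q / p) 1))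

      p∤Q/p : ¬ p ∣ Q / p
      p∤Q/p p∣Q/p with ∣1⇒≡1 (∣m+n∣m⇒∣n p∣Q/p+1 p∣Q/p)
      ... | refl = ℕP.<⇒≱ (prime⇒≥2 pr) (s≤s z≤n)

module Characterisation where

  open import Data.Integer using (+_)
  open import Data.Nat using (_+_; _*_; _^_; _≤_; _∸_; _/_)
  open import Data.Nat.Divisibility using (_∣_; divides; _∣?_; ∣-trans; ∣⇒≤; *-pres-∣; *-cancelˡ-∣; ∣n⇒∣m*n; ∣m+n∣m⇒∣n; m∣n/o⇒m*o∣n)
  import Data.Nat.DivMod as ℕDM
  open import Data.Nat.Primality using (Prime; prime⇒nonZero)
  open import Data.Integer.Divisibility.Signed using (∣⇒∣ᵤ; ∣ᵤ⇒∣)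
  open import Data.Product using (_,_)
  open import Data.Empty using (⊥-elim)
  open import Relation.Nullary using (¬_; yes; no)
  open import Data.Nat.Tactic.RingSolver using (solve-∀)
  open Congruence
  open Primes
  open Pseudoperfect
  open SelfPowerSum

  DivisorCondition : ℕ → ℕ → Set
  DivisorCondition Q n = ∀ p → Prime p → p ∣ Q → (p ∸ 1) ∣ Q * n

  NonDivisorCondition : ℕ → ℕ → Set
  NonDivisorCondition Q n = ∀ p → Prime p → ¬ p ∣ Q → p ∣ n → ¬ (p ∸ 1) ∣ Q * n

  S≡0-mod-prime^ : ∀ {p} (pr : Prime p) e M → 1 ≤ M → p ^ suc e ∣ M → ¬ (p ∸ 1) ∣ M →
                   + S M M ≡ 0ℤ mod + (p ^ suc e)
  S≡0-mod-prime^ pr e (suc m) _ with prime⇒≡2+ pr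
  ... | q , refl = ModPrimePower.S≡0 q pr e m

  S+M/p≡0-mod-prime^ : ∀ {p} (pr : Prime p) e M → 1 ≤ M → p ^ suc e ∣ M → (p ∸ 1) ∣ M →
                       + S M M ℤ.+ + (_/_ M p {{prime⇒nonZero pr}}) ≡ 0ℤ mod + (p ^ suc e)
  S+M/p≡0-mod-prime^ pr e (suc m) _ with prime⇒≡2+ pr
  ... | q , refl = ModPrimePower.S+M/p≡0 q pr e m

  ≡mod0⇒∣ℕ : ∀ {d a} → + a ≡ 0ℤ mod + d → d ∣ a
  ≡mod0⇒∣ℕ h = ∣⇒∣ᵤ (≡mod0⇒∣ h)

  module _ (Q n : ℕ) (Q≥1 : 1 ≤ Q) (n≥1 : 1 ≤ n) where

    private
      M = Q * n
      M≥1 : 1 ≤ M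
      M≥1 = ℕP.*-mono-≤ Q≥1 n≥1

    ¬∀prime^∣ : ∀ {p} → Prime p → ¬ (∀ e → p ^ e ∣ n)
    ¬∀prime^∣ {p} pr p^∣n = ℕP.<⇒≱ (n<m^n p n (prime⇒≥2 pr)) (∣⇒≤ {{ℕ.>-nonZero n≥1}} (p^∣n n))

    module _ (n∈𝔑 : In𝔑 Q n) where

      private
        S≡n : ∀ p e → p ^ suc e ∣ M → + S M M ≡ + n mod + (p ^ suc e)
        S≡n p e d = ≡mod-weaken (∣ᵤ⇒∣ d) (from-∣ n∈𝔑)

      -- Otherwise S M M ≡ 0 mod every power of p dividing M, forcing p ^ e ∣ n for all e.
      In𝔑⇒DivisorCondition : DivisorCondition Q n
      In𝔑⇒DivisorCondition p pr p∣Q with (p ∸ 1) ∣? M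
      ... | yes p-1∣M = p-1∣M
      ... | no p-1∤M = ⊥-elim (¬∀prime^∣ pr p^∣n)
        where
        p^∣n : ∀ e → p ^ e ∣ n
        p^∣n zero    = divides n (sym (ℕP.*-identityʳ n))
        p^∣n (suc e) = ≡mod0⇒∣ℕ (≡mod-trans (≡mod-sym (S≡n p e p^e+1∣M)) (S≡0-mod-prime^ pr e M M≥1 p^e+1∣M p-1∤M))
          where
          p^e+1∣M : p ^ suc e ∣ M
          p^e+1∣M = *-pres-∣ p∣Q (p^∣n e)

      In𝔑⇒NonDivisorCondition : NonDivisorCondition Q n
      In𝔑⇒NonDivisorCondition p pr p∤Q p∣n p-1∣M = ¬∀prime^∣ pr p^∣n
        where
        instance _ = prime⇒nonZero pr
        p^+1∣n : ∀ e → p ^ suc e ∣ n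
        p^+1∣n zero    = subst (_∣ n) (sym (ℕP.*-identityʳ p)) p∣n
        p^+1∣n (suc e) = subst (_∣ n) (ℕP.*-comm (p ^ suc e) p)
            (m∣n/o⇒m*o∣n p∣n (prime^∣*∧∤⇒∣ (suc e) pr p∤Q (subst (p ^ suc e ∣_) M/p≡Q*[n/p] p^∣M/p)))
          where
          p^∣M : p ^ suc e ∣ M
          p^∣M = ∣n⇒∣m*n Q (p^+1∣n e)
          n+M/p≡0 : + n ℤ.+ + (M / p) ≡ 0ℤ mod + (p ^ suc e)
          n+M/p≡0 = ≡mod-trans (+-cong-mod (≡mod-sym (S≡n p e p^∣M)) (≡mod-refl {a = + (M / p)}))
                      (S+M/p≡0-mod-prime^ pr e M M≥1 p^∣M p-1∣M)
          p^∣M/p : p ^ suc e ∣ M / p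
          p^∣M/p = ∣m+n∣m⇒∣n (≡mod0⇒∣ℕ (subst (λ z → z ≡ 0ℤ mod + (p ^ suc e)) (sym (ℤP.pos-+ n (M / p))) n+M/p≡0)) (p^+1∣n e)
          M/p≡Q*[n/p] : M / p ≡ Q * (n / p)
          M/p≡Q*[n/p] = trans (cong (_/ p) (trans (cong (Q *_) (sym (ℕDM.m/n*n≡m p∣n))) (sym (ℕP.*-assoc Q (n / p) p))))
                          (ℕDM.m*n/n≡m (Q * (n / p)) p)
        p^∣n : ∀ e → p ^ e ∣ n
        p^∣n zero    = divides n (sym (ℕP.*-identityʳ n))
        p^∣n (suc e) = p^+1∣n e

    conditions⇒In𝔑 : WeakPrimaryPseudoperfect Q → DivisorCondition Q n → NonDivisorCondition Q n → In𝔑 Q n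
    conditions⇒In𝔑 (_ , Q∣sum+1) c₁ c₂ = ∣ᵤ⇒∣ {k = + M} (prime^∣⇒∣ M M≥1 _ (λ p e pr d → ∣⇒∣ᵤ (to-∣ (S≡n p e pr d))))
      where
      S≡n : ∀ p e → Prime p → p ^ suc e ∣ M → + S M M ≡ + n mod + (p ^ suc e)
      S≡n p e pr p^∣M with p ∣? Q
      ... | yes p∣Q = ≡mod-cancel-+ {a = + (M / p)} (S+M/p≡0-mod-prime^ pr e M M≥1 p^∣M (c₁ p pr p∣Q)) n+M/p≡0
        where
        instance _ = prime⇒nonZero pr
        Q≡Q/p*p : Q ≡ Q / p * p
        Q≡Q/p*p = sym (ℕDM.m/n*n≡m p∣Q)
        M≡p*[Q/p*n] : M ≡ p * (Q / p * n)
        M≡p*[Q/p*n] = trans (cong (_* n) Q≡Q/p*p) (rearrange (Q / p) p n)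
          where
          rearrange : ∀ a p n → a * p * n ≡ p * (a * n)
          rearrange = solve-∀
        M/p≡Q/p*n : M / p ≡ Q / p * n
        M/p≡Q/p*n = trans (cong (_/ p) (trans M≡p*[Q/p*n] (ℕP.*-comm p _))) (ℕDM.m*n/n≡m (Q / p * n) p)
        p^e∣n : p ^ e ∣ n
        p^e∣n = prime^∣*∧∤⇒∣ e pr (p∤Q/p Q p pr p∣Q Q≥1 Q∣sum+1) (*-cancelˡ-∣ p (subst (p * p ^ e ∣_) M≡p*[Q/p*n] p^∣M))
        -- p ^ e ∣ n and p ∣ Q / p + 1 give p ^ (e + 1) ∣ n * (Q / p + 1) = n + M / p
        p^∣n+M/p : p ^ suc e ∣ n + M / p
        p^∣n+M/p = subst₂ _∣_ (ℕP.*-comm (p ^ e) p) (trans (expand n (Q / p)) (cong (λ z → n + z) (sym M/p≡Q/p*n)))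
                     (*-pres-∣ p^e∣n (p∣Q/p+1 Q p pr p∣Q Q≥1 Q∣sum+1))
          where
          expand : ∀ n a → n * (a + 1) ≡ n + a * n
          expand = solve-∀
        n+M/p≡0 : + n ℤ.+ + (M / p) ≡ 0ℤ mod + (p ^ suc e)
        n+M/p≡0 = subst (λ z → z ≡ 0ℤ mod + (p ^ suc e)) (ℤP.pos-+ n (M / p)) (∣⇒≡mod0 (∣ᵤ⇒∣ p^∣n+M/p))
      ... | no p∤Q = ≡mod-trans (S≡0-mod-prime^ pr e M M≥1 p^∣M p-1∤M) (≡mod-sym (∣⇒≡mod0 (∣ᵤ⇒∣ p^∣n)))
        where
        p^∣n : p ^ suc e ∣ n
        p^∣n = prime^∣*∧∤⇒∣ (suc e) pr p∤Q p^∣M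
        p-1∤M : ¬ (p ∸ 1) ∣ M
        p-1∤M = c₂ p pr p∤Q (∣-trans (divides (p ^ e) (ℕP.*-comm p (p ^ e))) p^∣n)

module Violations (Q : ℕ) where

  open import Data.Nat using (_+_; _*_; _≤_; _<_; _∸_; _!; z≤n; s≤s)
  open import Data.Nat.Divisibility using (_∣_; _∣?_; ∣⇒≤; ∣m+n∣m⇒∣n; ∣m∣n⇒∣m+n; ∣n⇒∣m*n)
  open import Data.Nat.Primality using (Prime; prime?)
  open import Data.Sum using (_⊎_; inj₁; inj₂)
  open import Data.Product using (∃; _×_; _,_; proj₁)
  open import Data.Empty using (⊥-elim)
  open import Function using (_⇔_; mk⇔; Equivalence)
  open import Relation.Nullary using (¬_; yes; no; Dec)
  open import Relation.Nullary.Decidable using (_×-dec_; _⊎-dec_; ¬?)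
  open Primes
  open Characterisation

  Violation : ℕ → ℕ → Set
  Violation p n = Prime p × ((p ∣ Q × ¬ (p ∸ 1) ∣ Q * n) ⊎ (¬ p ∣ Q × p ∣ n × (p ∸ 1) ∣ Q * n))

  violation? : ∀ p n → Dec (Violation p n)
  violation? p n = prime? p ×-dec ((p ∣? Q ×-dec ¬? ((p ∸ 1) ∣? Q * n)) ⊎-dec (¬? (p ∣? Q) ×-dec p ∣? n ×-dec (p ∸ 1) ∣? Q * n))

  ViolationUpTo : ℕ → ℕ → Set
  ViolationUpTo P n = ∃ λ p → p < suc P × Violation p n

  violationUpTo? : ∀ P n → Dec (ViolationUpTo P n)
  violationUpTo? P n = ℕP.anyUpTo? (λ p → violation? p n) (suc P)

  -- P ! is a multiple of p and of p - 1 for every prime p ≤ P.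
  violation-periodic : ∀ {P p} n → p ≤ P → Violation p (P ! + n) ⇔ Violation p n
  violation-periodic {P} {p} n p≤P = mk⇔ forward backward
    where
    shift : ∀ {d x} → d ∣ P ! → d ∣ P ! + x ⇔ d ∣ x
    shift d∣P! = mk⇔ (λ h → ∣m+n∣m⇒∣n h d∣P!) (∣m∣n⇒∣m+n d∣P!)
    Q*-shift : ∀ {d} → d ∣ P ! → d ∣ Q * (P ! + n) ⇔ d ∣ Q * n
    Q*-shift {d} d∣P! = mk⇔
      (λ h → ∣m+n∣m⇒∣n (subst (d ∣_) (ℕP.*-distribˡ-+ Q (P !) n) h) (∣n⇒∣m*n Q d∣P!))
      (λ h → subst (d ∣_) (sym (ℕP.*-distribˡ-+ Q (P !) n)) (∣m∣n⇒∣m+n (∣n⇒∣m*n Q d∣P!) h))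
    p∣P! : Prime p → p ∣ P !
    p∣P! pr = m∣n! (ℕP.≤-trans (s≤s z≤n) (prime⇒≥2 pr)) p≤P
    p-1∣P! : Prime p → (p ∸ 1) ∣ P !
    p-1∣P! pr with prime⇒≡2+ pr
    ... | q , refl = m∣n! (s≤s z≤n) (ℕP.≤-trans (ℕP.n≤1+n (suc q)) p≤P)
    forward : Violation p (P ! + n) → Violation p n
    forward (pr , inj₁ (p∣Q , h))         = pr , inj₁ (p∣Q , λ d → h (Equivalence.from (Q*-shift (p-1∣P! pr)) d))
    forward (pr , inj₂ (p∤Q , p∣n , d))   = pr , inj₂ (p∤Q , Equivalence.to (shift (p∣P! pr)) p∣n , Equivalence.to (Q*-shift (p-1∣P! pr)) d)
    backward : Violation p n → Violation p (P ! + n)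
    backward (pr , inj₁ (p∣Q , h))        = pr , inj₁ (p∣Q , λ d → h (Equivalence.to (Q*-shift (p-1∣P! pr)) d))
    backward (pr , inj₂ (p∤Q , p∣n , d))  = pr , inj₂ (p∤Q , Equivalence.from (shift (p∣P! pr)) p∣n , Equivalence.from (Q*-shift (p-1∣P! pr)) d)

  module _ (w : WeakPrimaryPseudoperfect Q) {n} (n≥1 : 1 ≤ n) where

    private
      Q≥1 : 1 ≤ Q
      Q≥1 = proj₁ w

    In𝔑⇒¬Violation : In𝔑 Q n → ∀ p → ¬ Violation p n
    In𝔑⇒¬Violation n∈𝔑 p (pr , inj₁ (p∣Q , p-1∤Qn))      = p-1∤Qn (In𝔑⇒DivisorCondition Q n Q≥1 n≥1 n∈𝔑 p pr p∣Q)
    In𝔑⇒¬Violation n∈𝔑 p (pr , inj₂ (p∤Q , p∣n , p-1∣Qn)) = In𝔑⇒NonDivisorCondition Q n Q≥1 n≥1 n∈𝔑 p pr p∤Q p∣n p-1∣Qn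

    -- Primes violating the conditions at n divide Q * n, so they are at most Q * n.
    ¬In𝔑⇒ViolationUpTo[Qn] : ¬ In𝔑 Q n → ViolationUpTo (Q * n) n
    ¬In𝔑⇒ViolationUpTo[Qn] n∉𝔑 with violationUpTo? (Q * n) n
    ... | yes v = v
    ... | no ¬v = ⊥-elim (n∉𝔑 (conditions⇒In𝔑 Q n Q≥1 n≥1 w divisorCondition nonDivisorCondition))
      where
      divisorCondition : DivisorCondition Q n
      divisorCondition p pr p∣Q with (p ∸ 1) ∣? Q * n
      ... | yes p-1∣Qn = p-1∣Qn
      ... | no p-1∤Qn  = ⊥-elim (¬v (p , s≤s (ℕP.≤-trans (∣⇒≤ {{ℕ.>-nonZero Q≥1}} p∣Q) (ℕP.m≤m*n Q n {{ℕ.>-nonZero n≥1}})) , pr , inj₁ (p∣Q , p-1∤Qn)))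
      nonDivisorCondition : NonDivisorCondition Q n
      nonDivisorCondition p pr p∤Q p∣n p-1∣Qn =
        ¬v (p , s≤s (ℕP.≤-trans (∣⇒≤ {{ℕ.>-nonZero n≥1}} p∣n) (ℕP.m≤n*m n Q {{ℕ.>-nonZero Q≥1}})) , pr , inj₂ (p∤Q , p∣n , p-1∣Qn))

module Tally where

  open import Data.Nat using (_+_; _*_; _≤_; _<_; _/_; _%_; z≤n; s≤s; NonZero)
  open import Data.Nat.Divisibility using (_∣?_; ∣⇒≤; ∣-refl; ∣m+n∣m⇒∣n; ∣m∣n⇒∣m+n)
  import Data.Nat.DivMod as ℕDM
  open import Data.Sum using (inj₁; inj₂)
  open import Data.Empty using (⊥-elim)
  open import Relation.Nullary using (yes; no; Dec)
  open import Data.Nat.Tactic.RingSolver using (solve-∀)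

  indicator : ∀ {A : Set} → Dec A → ℕ
  indicator (yes _) = 1
  indicator (no _)  = 0

  indicator≤1 : ∀ {A : Set} (a : Dec A) → indicator a ≤ 1
  indicator≤1 (yes _) = s≤s z≤n
  indicator≤1 (no _)  = z≤n

  indicator-cong : ∀ {A B : Set} (a : Dec A) (b : Dec B) → (A → B) → (B → A) → indicator a ≡ indicator b
  indicator-cong (yes _) (yes _) f g = refl
  indicator-cong (yes x) (no ¬y) f g = ⊥-elim (¬y (f x))
  indicator-cong (no ¬x) (yes y) f g = ⊥-elim (¬x (g y))
  indicator-cong (no _)  (no _)  f g = refl

  indicator-mono : ∀ {A B : Set} (a : Dec A) (b : Dec B) → (A → B) → indicator a ≤ indicator b
  indicator-mono (yes _) (yes _) f = ℕP.≤-refl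
  indicator-mono (yes x) (no ¬y) f = ⊥-elim (¬y (f x))
  indicator-mono (no _)  b       f = z≤n

  tally : (ℕ → ℕ) → ℕ → ℕ
  tally g zero    = 0
  tally g (suc N) = g (suc N) + tally g N

  sumBelow : (ℕ → ℕ) → ℕ → ℕ
  sumBelow g zero    = 0
  sumBelow g (suc L) = sumBelow g L + g L

  tally-mono-≤ : ∀ {g h} N → (∀ n → 1 ≤ n → n ≤ N → g n ≤ h n) → tally g N ≤ tally h N
  tally-mono-≤ zero    g≤h = z≤n
  tally-mono-≤ (suc N) g≤h = ℕP.+-mono-≤ (g≤h (suc N) (s≤s z≤n) ℕP.≤-refl) (tally-mono-≤ N (λ n n≥1 n≤N → g≤h n n≥1 (ℕP.m≤n⇒m≤1+n n≤N)))

  tally-cong : ∀ {g h} N → (∀ n → g n ≡ h n) → tally g N ≡ tally h N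
  tally-cong zero    g≡h = refl
  tally-cong (suc N) g≡h = cong₂ _+_ (g≡h (suc N)) (tally-cong N g≡h)

  tally-distrib-+ : ∀ g h N → tally (λ n → g n + h n) N ≡ tally g N + tally h N
  tally-distrib-+ g h zero    = refl
  tally-distrib-+ g h (suc N) rewrite tally-distrib-+ g h N = lemma (g (suc N)) (h (suc N)) (tally g N) (tally h N)
    where
    lemma : ∀ a b c d → a + b + (c + d) ≡ a + c + (b + d)
    lemma = solve-∀

  tally≤ : ∀ g N → (∀ n → g n ≤ 1) → tally g N ≤ N
  tally≤ g zero    g≤1 = z≤n
  tally≤ g (suc N) g≤1 = ℕP.+-mono-≤ (g≤1 (suc N)) (tally≤ g N g≤1)

  tally-+ : ∀ g a b → tally g (a + b) ≡ tally g a + tally (λ n → g (a + n)) b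
  tally-+ g a zero    = trans (cong (tally g) (ℕP.+-identityʳ a)) (sym (ℕP.+-identityʳ _))
  tally-+ g a (suc b) rewrite ℕP.+-suc a b | tally-+ g a b = lemma (g (suc (a + b))) (tally g a) _
    where
    lemma : ∀ x y z → x + (y + z) ≡ y + (x + z)
    lemma = solve-∀

  tally-periodic : ∀ g T → (∀ n → g (T + n) ≡ g n) → ∀ q r → tally g (q * T + r) ≡ q * tally g T + tally g r
  tally-periodic g T per zero    r = refl
  tally-periodic g T per (suc q) r = begin
    tally g (T + q * T + r)                         ≡⟨ cong (tally g) (ℕP.+-assoc T (q * T) r) ⟩
    tally g (T + (q * T + r))                       ≡⟨ tally-+ g T (q * T + r) ⟩
    tally g T + tally (λ n → g (T + n)) (q * T + r) ≡⟨ cong (λ z → tally g T + z) (tally-cong (q * T + r) per) ⟩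
    tally g T + tally g (q * T + r)                 ≡⟨ cong (λ z → tally g T + z) (tally-periodic g T per q r) ⟩
    tally g T + (q * tally g T + tally g r)         ≡⟨ sym (ℕP.+-assoc (tally g T) (q * tally g T) (tally g r)) ⟩
    tally g T + q * tally g T + tally g r           ∎
    where open ≡-Reasoning

  term≤sumBelow : ∀ g L i → i < L → g i ≤ sumBelow g L
  term≤sumBelow g (suc L) i i<L+1 with ℕP.m<1+n⇒m<n∨m≡n i<L+1
  ... | inj₁ i<L = ℕP.≤-trans (term≤sumBelow g L i i<L) (ℕP.m≤m+n (sumBelow g L) (g L))
  ... | inj₂ refl = ℕP.m≤n+m (g L) (sumBelow g L)

  tally-sumBelow-comm : ∀ (f : ℕ → ℕ → ℕ) N L → tally (λ n → sumBelow (λ i → f i n) L) N ≡ sumBelow (λ i → tally (f i) N) L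
  tally-sumBelow-comm f N zero    = tally-0 N
    where
    tally-0 : ∀ N → tally (λ _ → 0) N ≡ 0
    tally-0 zero    = refl
    tally-0 (suc N) = tally-0 N
  tally-sumBelow-comm f N (suc L) =
    trans (tally-distrib-+ (λ n → sumBelow (λ i → f i n) L) (f L) N) (cong (_+ tally (f L) N) (tally-sumBelow-comm f N L))

  𝟙∣ : ℕ → ℕ → ℕ
  𝟙∣ d x = indicator (d ∣? x)

  tally-𝟙∣ : ∀ d .{{_ : NonZero d}} N → tally (𝟙∣ d) N ≡ N / d
  tally-𝟙∣ d@(suc d′) N = begin
    tally (𝟙∣ d) N                                  ≡⟨ cong (tally (𝟙∣ d)) N≡ ⟩
    tally (𝟙∣ d) (N / d * d + N % d)                ≡⟨ tally-periodic (𝟙∣ d) d shift (N / d) (N % d) ⟩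
    N / d * tally (𝟙∣ d) d + tally (𝟙∣ d) (N % d)   ≡⟨ cong₂ (λ x y → N / d * x + y) self (below (N % d) (ℕDM.m%n<n N d)) ⟩
    N / d * 1 + 0                                   ≡⟨ trans (ℕP.+-identityʳ _) (ℕP.*-identityʳ (N / d)) ⟩
    N / d                                           ∎
    where
    open ≡-Reasoning
    N≡ : N ≡ N / d * d + N % d
    N≡ = trans (ℕDM.m≡m%n+[m/n]*n N d) (ℕP.+-comm (N % d) (N / d * d))
    shift : ∀ n → 𝟙∣ d (d + n) ≡ 𝟙∣ d n
    shift n = indicator-cong (d ∣? (d + n)) (d ∣? n) (λ h → ∣m+n∣m⇒∣n h ∣-refl) (∣m∣n⇒∣m+n ∣-refl)
    below : ∀ r → r < d → tally (𝟙∣ d) r ≡ 0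
    below zero    _       = refl
    below (suc r) r+1<d with d ∣? suc r
    ... | yes d∣r+1 = ⊥-elim (ℕP.<⇒≱ r+1<d (∣⇒≤ d∣r+1))
    ... | no _      = below r (ℕP.<-trans (ℕP.n<1+n r) r+1<d)
    self : tally (𝟙∣ d) d ≡ 1
    self with d ∣? d
    ... | yes _    = cong suc (below d′ (ℕP.n<1+n d′))
    ... | no ¬d∣d = ⊥-elim (¬d∣d ∣-refl)

  tally-𝟙∣*d≤ : ∀ d .{{_ : NonZero d}} N → tally (𝟙∣ d) N * d ≤ N
  tally-𝟙∣*d≤ d N = subst (λ z → z * d ≤ N) (sym (tally-𝟙∣ d N)) (ℕDM.m/n*n≤m N d)

  last≤tally : ∀ h N → 1 ≤ N → h N ≤ tally h N
  last≤tally h (suc N) _ = ℕP.m≤m+n (h (suc N)) (tally h N)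

  tally-∘*≤ : ∀ g Q N → 1 ≤ Q → tally (λ n → g (Q * n)) N ≤ tally g (Q * N)
  tally-∘*≤ g Q zero    _   = z≤n
  tally-∘*≤ g Q (suc N) Q≥1 = begin
    g (Q * suc N) + tally (λ n → g (Q * n)) N      ≤⟨ ℕP.+-mono-≤ last≤ (tally-∘*≤ g Q N Q≥1) ⟩
    tally (λ n → g (Q * N + n)) Q + tally g (Q * N) ≡⟨ ℕP.+-comm _ (tally g (Q * N)) ⟩
    tally g (Q * N) + tally (λ n → g (Q * N + n)) Q ≡⟨ sym (tally-+ g (Q * N) Q) ⟩
    tally g (Q * N + Q)                             ≡⟨ cong (tally g) (sym Q*[N+1]≡) ⟩
    tally g (Q * suc N)                             ∎
    where
    open ℕP.≤-Reasoning
    Q*[N+1]≡ : Q * suc N ≡ Q * N + Q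
    Q*[N+1]≡ = trans (ℕP.*-suc Q N) (ℕP.+-comm Q (Q * N))
    last≤ : g (Q * suc N) ≤ tally (λ n → g (Q * N + n)) Q
    last≤ = subst (λ z → g z ≤ tally (λ n → g (Q * N + n)) Q) (sym Q*[N+1]≡) (last≤tally (λ n → g (Q * N + n)) Q Q≥1)

  tally-𝟙∣-Q*≤ : ∀ Q d .{{_ : NonZero d}} N → 1 ≤ Q → tally (λ n → 𝟙∣ d (Q * n)) N * d ≤ Q * N
  tally-𝟙∣-Q*≤ Q d N Q≥1 = ℕP.≤-trans (ℕP.*-monoˡ-≤ d (tally-∘*≤ (𝟙∣ d) Q N Q≥1)) (tally-𝟙∣*d≤ d (Q * N))

  -- Strengthened for the induction, since ∑_{i < L} 1 / ((P + i + 1) (P + i)) = 1 / P - 1 / (P + L).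
  telescoping-bound′ : ∀ P (c : ℕ → ℕ) X → 1 ≤ P → (∀ i → c (suc (P + i)) * (suc (P + i) * (P + i)) ≤ X) →
                       ∀ L → P * (P + L) * sumBelow (λ i → c (suc (P + i))) L ≤ X * L
  telescoping-bound′ P c X P≥1 c≤ zero    = ℕP.≤-reflexive (trans (ℕP.*-zeroʳ (P * (P + 0))) (sym (ℕP.*-zeroʳ X)))
  telescoping-bound′ P c X P≥1 c≤ (suc L) = ℕP.*-cancelˡ-≤ (P + L) {{ℕ.>-nonZero (ℕP.≤-trans P≥1 (ℕP.m≤m+n P L))}} (begin
    (P + L) * (P * (P + suc L) * (E + cL))                                  ≡⟨ expand ⟩
    suc (P + L) * (P * (P + L) * E) + P * (cL * (suc (P + L) * (P + L)))   ≤⟨ ℕP.+-mono-≤ (ℕP.*-monoʳ-≤ (suc (P + L)) ih) (ℕP.*-monoʳ-≤ P (c≤ L)) ⟩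
    suc (P + L) * (X * L) + P * X                                           ≡⟨ lemma P L X ⟩
    (P + L) * (X * suc L)                                                   ∎)
    where
    open ℕP.≤-Reasoning
    E : ℕ
    E = sumBelow (λ i → c (suc (P + i))) L
    cL : ℕ
    cL = c (suc (P + L))
    ih : P * (P + L) * E ≤ X * L
    ih = telescoping-bound′ P c X P≥1 c≤ L
    lemma : ∀ P L X → suc (P + L) * (X * L) + P * X ≡ (P + L) * (X * suc L)
    lemma = solve-∀
    expand : (P + L) * (P * (P + suc L) * (E + cL)) ≡ suc (P + L) * (P * (P + L) * E) + P * (cL * (suc (P + L) * (P + L)))
    expand = trans (cong (λ z → (P + L) * (P * z * (E + cL))) (ℕP.+-suc P L)) (lemma′ P L E cL)
      where
      lemma′ : ∀ P L E c → (P + L) * (P * suc (P + L) * (E + c)) ≡ suc (P + L) * (P * (P + L) * E) + P * (c * (suc (P + L) * (P + L)))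
      lemma′ = solve-∀

  telescoping-bound : ∀ P (c : ℕ → ℕ) X → 1 ≤ P → (∀ i → c (suc (P + i)) * (suc (P + i) * (P + i)) ≤ X) →
                      ∀ L → P * sumBelow (λ i → c (suc (P + i))) L ≤ X
  telescoping-bound P c X P≥1 c≤ L = ℕP.*-cancelˡ-≤ (P + L) {{ℕ.>-nonZero (ℕP.≤-trans P≥1 (ℕP.m≤m+n P L))}}
    (subst₂ _≤_ (lemma P L (sumBelow (λ i → c (suc (P + i))) L)) (ℕP.*-comm X (P + L))
      (ℕP.≤-trans (telescoping-bound′ P c X P≥1 c≤ L) (ℕP.*-monoʳ-≤ X (ℕP.m≤n+m L P))))
    where
    lemma : ∀ P L E → P * (P + L) * E ≡ (P + L) * (P * E)
    lemma = solve-∀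

  periodic-upper-bound : ∀ a A c T N q r Ar → N ≡ q * T + r → r < T → A ≡ q * c + Ar → Ar ≤ r → a ≤ A →
           a * T ≤ c * N + T * T
  periodic-upper-bound a A c T N q r Ar N≡ r<T A≡ Ar≤r a≤A = begin
    a * T ≤⟨ ℕP.*-monoˡ-≤ T a≤A ⟩
    A * T ≡⟨ cong (_* T) A≡ ⟩
    (q * c + Ar) * T ≡⟨ ℕP.*-distribʳ-+ T (q * c) Ar ⟩
    q * c * T + Ar * T ≤⟨ ℕP.+-mono-≤ (ℕP.≤-trans (ℕP.≤-reflexive (lemma₁ q c T)) (ℕP.*-monoʳ-≤ c (ℕP.m≤m+n (q * T) r))) (ℕP.*-monoˡ-≤ T (ℕP.≤-trans Ar≤r (ℕP.<⇒≤ r<T))) ⟩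
    c * (q * T + r) + T * T ≡⟨ cong (λ z → c * z + T * T) (sym N≡) ⟩
    c * N + T * T ∎
    where
    open ℕP.≤-Reasoning
    lemma₁ : ∀ q c T → q * c * T ≡ c * (q * T)
    lemma₁ = solve-∀

  periodic-lower-bound : ∀ a A c T N q r Ar P Q → N ≡ q * T + r → r < T → A ≡ q * c + Ar → c ≤ T →
           P * A ≤ P * a + Q * N → P * c * N ≤ P * T * a + Q * N * T + P * T * T
  periodic-lower-bound a A c T N q r Ar P Q N≡ r<T A≡ c≤T PA≤ = begin
    P * c * N ≡⟨ cong (λ z → P * c * z) N≡ ⟩
    P * c * (q * T + r) ≡⟨ lemma₁ P c q T r ⟩
    P * ((q * c) * T + c * r) ≤⟨ ℕP.*-monoʳ-≤ P (ℕP.+-mono-≤ (ℕP.*-monoˡ-≤ T (ℕP.≤-trans (ℕP.m≤m+n (q * c) Ar) (ℕP.≤-reflexive (sym A≡)))) (ℕP.*-mono-≤ c≤T (ℕP.<⇒≤ r<T))) ⟩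
    P * (A * T + T * T) ≡⟨ lemma₂ P A T ⟩
    (P * A) * T + P * T * T ≤⟨ ℕP.+-monoˡ-≤ (P * T * T) (ℕP.*-monoˡ-≤ T PA≤) ⟩
    (P * a + Q * N) * T + P * T * T ≡⟨ lemma₃ P a Q N T ⟩
    P * T * a + Q * N * T + P * T * T ∎
    where
    open ℕP.≤-Reasoning
    lemma₁ : ∀ P c q T r → P * c * (q * T + r) ≡ P * ((q * c) * T + c * r)
    lemma₁ = solve-∀
    lemma₂ : ∀ P A T → P * (A * T + T * T) ≡ (P * A) * T + P * T * T
    lemma₂ = solve-∀
    lemma₃ : ∀ P a Q N T → (P * a + Q * N) * T + P * T * T ≡ P * T * a + Q * N * T + P * T * T
    lemma₃ = solve-∀

  cross-multiplied-cauchy : ∀ k T c Q am an m n .{{_ : ℕ.NonZero Q}} .{{_ : ℕ.NonZero T}} →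
          am * T ≤ c * m + T * T →
          (Q * k) * c * n ≤ (Q * k) * T * an + Q * n * T + (Q * k) * T * T →
          k * T ≤ m → k * T ≤ n →
          k * am * n ≤ k * an * m + 3 * m * n
  cross-multiplied-cauchy k T c Q am an m n upper lower kT≤m kT≤n = ℕP.*-cancelˡ-≤ T (begin
    T * (k * am * n) ≡⟨ lemma₁ T k am n ⟩
    k * n * (am * T) ≤⟨ ℕP.*-monoʳ-≤ (k * n) upper ⟩
    k * n * (c * m + T * T) ≡⟨ lemma₂ k n c m T ⟩
    m * (k * c * n) + k * n * T * T ≤⟨ ℕP.+-monoˡ-≤ (k * n * T * T) (ℕP.*-monoʳ-≤ m lower′) ⟩
    m * (k * T * an + n * T + k * T * T) + k * n * T * T ≡⟨ lemma₃ m k T an n ⟩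
    T * (k * an * m + n * m + (k * T) * m + (k * T) * n) ≤⟨ ℕP.*-monoʳ-≤ T (ℕP.+-mono-≤ (ℕP.+-monoʳ-≤ (k * an * m + n * m) (ℕP.*-monoˡ-≤ m kT≤n)) (ℕP.*-monoˡ-≤ n kT≤m)) ⟩
    T * (k * an * m + n * m + n * m + m * n) ≡⟨ cong (T *_) (lemma₄ k an m n) ⟩
    T * (k * an * m + 3 * m * n) ∎)
    where
    open ℕP.≤-Reasoning
    lower′ : k * c * n ≤ k * T * an + n * T + k * T * T
    lower′ = ℕP.*-cancelˡ-≤ Q (subst₂ _≤_ (lemma₅ Q k c n) (lemma₆ Q k T an n) lower)
      where
      lemma₅ : ∀ Q k c n → Q * k * c * n ≡ Q * (k * c * n)
      lemma₅ = solve-∀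
      lemma₆ : ∀ Q k T an n → Q * k * T * an + Q * n * T + Q * k * T * T ≡ Q * (k * T * an + n * T + k * T * T)
      lemma₆ = solve-∀
    lemma₁ : ∀ T k am n → T * (k * am * n) ≡ k * n * (am * T)
    lemma₁ = solve-∀
    lemma₂ : ∀ k n c m T → k * n * (c * m + T * T) ≡ m * (k * c * n) + k * n * T * T
    lemma₂ = solve-∀
    lemma₃ : ∀ m k T an n → m * (k * T * an + n * T + k * T * T) + k * n * T * T ≡ T * (k * an * m + n * m + (k * T) * m + (k * T) * n)
    lemma₃ = solve-∀
    lemma₄ : ∀ k an m n → k * an * m + n * m + n * m + m * n ≡ k * an * m + 3 * m * n
    lemma₄ = solve-∀

module RationalBounds where

  open import Data.Integer using (+_; +<+; +≤+) renaming (_*_ to _*ᶻ_; _-_ to _-ᶻ_; _≤_ to _≤ᶻ_)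
  import Data.Integer.GCD as ℤGCD
  open import Data.Rational using (ℚ; mkℚ; 0ℚ; toℚᵘ; _/_; _-_; -_; ∣_∣; _≤_; _<_; *<*)
  import Data.Rational.Properties as ℚP
  open import Data.Rational.Unnormalised using (*≤*; *≡*) renaming (_/_ to _/ᵘ_; _-_ to _-ᵘ_; -_ to -ᵘ_; _≃_ to _≃ᵘ_; _≤_ to _≤ᵘ_)
  import Data.Rational.Unnormalised as ℚᵘ
  import Data.Rational.Unnormalised.Properties as ℚᵘP
  open import Data.Sum using (inj₁; inj₂)
  open import Data.Product using (Σ; _,_)
  open import Data.Integer.Tactic.RingSolver using (solve-∀)

  -- Inequalities between fractions are checked in ℚᵘ, where _/ᵘ_ keeps numerator and denominator unreduced.
  toℚᵘ-/ : ∀ i n .{{_ : ℕ.NonZero n}} → toℚᵘ (i / n) ≃ᵘ (i /ᵘ n)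
  toℚᵘ-/ i n@(suc _) with i / n | ℚP.↥-/ i n | ℚP.↧-/ i n
  ... | mkℚ a b _ | ↥*g≡i | ↧*g≡n = *≡* (cross a (+ suc b) (ℤGCD.gcd i (+ n)) i (+ n) ↥*g≡i ↧*g≡n)
    where
    cross : ∀ a b g i m → a *ᶻ g ≡ i → b *ᶻ g ≡ m → a *ᶻ m ≡ i *ᶻ b
    cross a b g i m refl refl = lemma a b g
      where
      lemma : ∀ a b g → a *ᶻ (b *ᶻ g) ≡ a *ᶻ g *ᶻ b
      lemma = solve-∀

  toℚᵘ-/-/ : ∀ x y b d .{{_ : ℕ.NonZero b}} .{{_ : ℕ.NonZero d}} → toℚᵘ (x / b - y / d) ≃ᵘ (x /ᵘ b) -ᵘ (y /ᵘ d)
  toℚᵘ-/-/ x y b d = ℚᵘP.≃-trans (ℚP.toℚᵘ-homo-+ (x / b) (- (y / d)))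
    (ℚᵘP.+-cong (toℚᵘ-/ x b) (ℚᵘP.≃-trans (ℚP.toℚᵘ-homo‿- (y / d)) (ℚᵘP.-‿cong (toℚᵘ-/ y d))))

  x/b-y/d≤z/k : ∀ x y z b d k .{{_ : ℕ.NonZero b}} .{{_ : ℕ.NonZero d}} .{{_ : ℕ.NonZero k}} →
                (x *ᶻ + d -ᶻ y *ᶻ + b) *ᶻ + k ≤ᶻ z *ᶻ + (b ℕ.* d) →
                x / b - y / d ≤ z / k
  x/b-y/d≤z/k x y z b@(suc _) d@(suc _) k@(suc _) h =
    ℚP.toℚᵘ-cancel-≤ (ℚᵘP.≤-respˡ-≃ (ℚᵘP.≃-sym (toℚᵘ-/-/ x y b d)) (ℚᵘP.≤-respʳ-≃ (ℚᵘP.≃-sym (toℚᵘ-/ z k))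
      (*≤* (subst (_≤ᶻ z *ᶻ + (b ℕ.* d)) (lemma x y (+ b) (+ d) (+ k)) h))))
    where
    lemma : ∀ x y b d k → (x *ᶻ d -ᶻ y *ᶻ b) *ᶻ k ≡ (x *ᶻ d ℤ.+ ℤ.- y *ᶻ b) *ᶻ k
    lemma = solve-∀

  -[x/b-y/d]≤z/k : ∀ x y z b d k .{{_ : ℕ.NonZero b}} .{{_ : ℕ.NonZero d}} .{{_ : ℕ.NonZero k}} →
                   (y *ᶻ + b -ᶻ x *ᶻ + d) *ᶻ + k ≤ᶻ z *ᶻ + (b ℕ.* d) →
                   - (x / b - y / d) ≤ z / k
  -[x/b-y/d]≤z/k x y z b@(suc _) d@(suc _) k@(suc _) h =
    ℚP.toℚᵘ-cancel-≤ (ℚᵘP.≤-respˡ-≃ (ℚᵘP.≃-sym (ℚᵘP.≃-trans (ℚP.toℚᵘ-homo‿- _) (ℚᵘP.-‿cong (toℚᵘ-/-/ x y b d))))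
      (ℚᵘP.≤-respʳ-≃ (ℚᵘP.≃-sym (toℚᵘ-/ z k)) (*≤* (subst (_≤ᶻ z *ᶻ + (b ℕ.* d)) (lemma x y (+ b) (+ d) (+ k)) h))))
    where
    lemma : ∀ x y b d k → (y *ᶻ b -ᶻ x *ᶻ d) *ᶻ k ≡ ℤ.- (x *ᶻ d ℤ.+ ℤ.- y *ᶻ b) *ᶻ k
    lemma = solve-∀

  x/b≤y/d-z/k : ∀ x y z b d k .{{_ : ℕ.NonZero b}} .{{_ : ℕ.NonZero d}} .{{_ : ℕ.NonZero k}} →
                x *ᶻ (+ d *ᶻ + k) ≤ᶻ (y *ᶻ + k -ᶻ z *ᶻ + d) *ᶻ + b →
                x / b ≤ y / d - z / k
  x/b≤y/d-z/k x y z b@(suc _) d@(suc _) k@(suc _) h =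
    ℚP.toℚᵘ-cancel-≤ (ℚᵘP.≤-respʳ-≃ (ℚᵘP.≃-sym (toℚᵘ-/-/ y z d k)) (ℚᵘP.≤-respˡ-≃ (ℚᵘP.≃-sym (toℚᵘ-/ x b))
      (*≤* (subst (x *ᶻ (+ d *ᶻ + k) ≤ᶻ_) (lemma y z (+ b) (+ d) (+ k)) h))))
    where
    lemma : ∀ y z b d k → (y *ᶻ k -ᶻ z *ᶻ d) *ᶻ b ≡ (y *ᶻ k ℤ.+ ℤ.- z *ᶻ d) *ᶻ b
    lemma = solve-∀

  ∣p∣≤q : ∀ p q → p ≤ q → - p ≤ q → ∣ p ∣ ≤ q
  ∣p∣≤q p q p≤q -p≤q with ℚP.∣p∣≡p∨∣p∣≡-p p
  ... | inj₁ ∣p∣≡p  = subst (_≤ q) (sym ∣p∣≡p) p≤q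
  ... | inj₂ ∣p∣≡-p = subst (_≤ q) (sym ∣p∣≡-p) -p≤q

  ∃3/k≤ε : ∀ ε → 0ℚ < ε → Σ ℕ λ k → Σ (ℕ.NonZero k) λ k≢0 → (+ 3 / k) {{k≢0}} ≤ ε
  ∃3/k≤ε (mkℚ (+ suc u) v _) _ = 3 ℕ.* suc v , _ ,
    ℚP.toℚᵘ-cancel-≤ (ℚᵘP.≤-respˡ-≃ (ℚᵘP.≃-sym (toℚᵘ-/ (+ 3) (3 ℕ.* suc v))) (*≤* (+≤+ (ℕP.m≤n*m (3 ℕ.* suc v) (suc u)))))
  ∃3/k≤ε (mkℚ (+ zero) v _) (*<* (+<+ ()))
  ∃3/k≤ε (mkℚ ℤ.-[1+ u ] v _) (*<* ())

  0<1/n : ∀ n .{{_ : ℕ.NonZero n}} → 0ℚ < + 1 / n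
  0<1/n n@(suc _) = ℚP.toℚᵘ-cancel-< (ℚᵘP.<-respʳ-≃ (ℚᵘP.≃-sym (toℚᵘ-/ (+ 1) n)) (ℚᵘ.*<* (+<+ (ℕ.s≤s ℕ.z≤n))))

module Approximation (Q : ℕ) (w : WeakPrimaryPseudoperfect Q) where

  open import Data.Nat using (_+_; _*_; _≤_; _<_; _∸_; _!; z≤n; s≤s)
  open import Data.Nat.Divisibility using (_∣_; _∣?_; ∣⇒≤; ∣n⇒∣m*n)
  import Data.Nat.DivMod as ℕDM
  open import Data.Integer using (+_)
  open import Data.Product using (Σ; _,_; proj₁)
  open import Data.Sum using (inj₁; inj₂)
  open import Data.Empty using (⊥-elim)
  open import Function using (Equivalence)
  open import Relation.Nullary using (yes; no; Dec)
  open import Relation.Nullary.Decidable using (¬?)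
  open Primes
  open Violations Q
  open Tally

  private
    Q≥1 : 1 ≤ Q
    Q≥1 = proj₁ w

  in𝔑? : ∀ n → Dec (In𝔑 Q n)
  in𝔑? n = + (Q * n) ℤD.∣? (+ S (Q * n) (Q * n) ℤ.- + n)

  𝟙𝔑 : ℕ → ℕ
  𝟙𝔑 n = indicator (in𝔑? n)

  count≡tally : ∀ N → count Q N ≡ tally 𝟙𝔑 N
  count≡tally zero = refl
  count≡tally (suc N) with in𝔑? (suc N)
  ... | yes _ = cong suc (count≡tally N)
  ... | no _  = count≡tally N

  𝟙A : ℕ → ℕ → ℕ
  𝟙A P n = indicator (¬? (violationUpTo? P n))

  𝟙A≤1 : ∀ P n → 𝟙A P n ≤ 1
  𝟙A≤1 P n = indicator≤1 (¬? (violationUpTo? P n))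

  𝟙𝔑≤𝟙A : ∀ P n → 1 ≤ n → 𝟙𝔑 n ≤ 𝟙A P n
  𝟙𝔑≤𝟙A P n n≥1 = indicator-mono (in𝔑? n) (¬? (violationUpTo? P n))
    λ n∈𝔑 (p , _ , v) → In𝔑⇒¬Violation w n≥1 n∈𝔑 p v

  𝟙A-periodic : ∀ P n → 𝟙A P (P ! + n) ≡ 𝟙A P n
  𝟙A-periodic P n = indicator-cong (¬? (violationUpTo? P (P ! + n))) (¬? (violationUpTo? P n))
    (λ ¬v (p , p<P+1 , v) → ¬v (p , p<P+1 , Equivalence.from (violation-periodic n (ℕP.≤-pred p<P+1)) v))
    (λ ¬v (p , p<P+1 , v) → ¬v (p , p<P+1 , Equivalence.to (violation-periodic n (ℕP.≤-pred p<P+1)) v))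

  -- 𝟙∣ (j (j - 1)) (Q n), where j = P + 1 + i runs over the candidates for a prime p > P violating at n
  largePrimeTerm : ℕ → ℕ → ℕ → ℕ
  largePrimeTerm P n i = 𝟙∣ (suc (P + i) * (P + i)) (Q * n)

  -- A prime p > P violating at n has p ∤ Q, p ∣ n and p - 1 ∣ Q n, hence p (p - 1) ∣ Q n.
  𝟙A≤𝟙𝔑+∑ : ∀ P N n → Q ≤ P → 1 ≤ n → n ≤ N → 𝟙A P n ≤ 𝟙𝔑 n + sumBelow (largePrimeTerm P n) N
  𝟙A≤𝟙𝔑+∑ P N n Q≤P n≥1 n≤N with violationUpTo? P n
  ... | yes _ = z≤n
  ... | no ¬v with in𝔑? n
  ...   | yes _   = s≤s z≤n
  ...   | no n∉𝔑 with ¬In𝔑⇒ViolationUpTo[Qn] w n≥1 n∉𝔑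
  ...     | p , _ , v@(pr , inj₁ (p∣Q , _)) = ⊥-elim (¬v (p , s≤s (ℕP.≤-trans (∣⇒≤ {{ℕ.>-nonZero Q≥1}} p∣Q) Q≤P) , v))
  ...     | p , _ , v@(pr , inj₂ (_ , p∣n , p-1∣Qn)) =
    ℕP.≤-trans (ℕP.≤-reflexive (sym term≡1)) (term≤sumBelow (largePrimeTerm P n) N i i<N)
    where
    P<p : P < p
    P<p = ℕP.≰⇒> λ p≤P → ¬v (p , s≤s p≤P , v)
    i : ℕ
    i = p ∸ suc P
    i+P+1≡p : i + suc P ≡ p
    i+P+1≡p = ℕP.m∸n+n≡m P<p
    i<N : i < N
    i<N = ℕP.<-≤-trans (subst (i <_) i+P+1≡p (ℕP.m<m+n i (s≤s z≤n))) (ℕP.≤-trans (∣⇒≤ {{ℕ.>-nonZero n≥1}} p∣n) n≤N)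
    P+i+1≡p : suc (P + i) ≡ p
    P+i+1≡p = trans (cong suc (ℕP.+-comm P i)) (trans (sym (ℕP.+-suc i P)) i+P+1≡p)
    p[p-1]∣Qn : p * (p ∸ 1) ∣ Q * n
    p[p-1]∣Qn = prime∣*∧∤⇒*∣ pr (∣n⇒∣m*n Q p∣n) p-1∣Qn (prime∤pred pr)
    term≡1 : largePrimeTerm P n i ≡ 1
    term≡1 = trans (cong (λ j → 𝟙∣ (j * (j ∸ 1)) (Q * n)) P+i+1≡p) 𝟙∣p[p-1]≡1
      where
      𝟙∣p[p-1]≡1 : 𝟙∣ (p * (p ∸ 1)) (Q * n) ≡ 1
      𝟙∣p[p-1]≡1 with p * (p ∸ 1) ∣? Q * n
      ... | yes _   = refl
      ... | no ¬div = ⊥-elim (¬div p[p-1]∣Qn)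

  -- ∑_{p > P} #{n ≤ N : p (p - 1) ∣ Q n} ≤ ∑_{j > P} Q N / (j (j - 1)) ≤ Q N / P
  P*tally𝟙A≤ : ∀ P N → Q ≤ P → 1 ≤ P → P * tally (𝟙A P) N ≤ P * tally 𝟙𝔑 N + Q * N
  P*tally𝟙A≤ P N Q≤P P≥1 = begin
    P * tally (𝟙A P) N            ≤⟨ ℕP.*-monoʳ-≤ P (tally-mono-≤ N (λ n n≥1 n≤N → 𝟙A≤𝟙𝔑+∑ P N n Q≤P n≥1 n≤N)) ⟩
    P * tally (λ n → 𝟙𝔑 n + sumBelow (largePrimeTerm P n) N) N
      ≡⟨ cong (P *_) (trans (tally-distrib-+ 𝟙𝔑 _ N) (cong (λ z → tally 𝟙𝔑 N + z) (tally-sumBelow-comm (λ i n → largePrimeTerm P n i) N N))) ⟩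
    P * (tally 𝟙𝔑 N + E)          ≡⟨ ℕP.*-distribˡ-+ P (tally 𝟙𝔑 N) E ⟩
    P * tally 𝟙𝔑 N + P * E        ≤⟨ ℕP.+-monoʳ-≤ (P * tally 𝟙𝔑 N) tail-bound ⟩
    P * tally 𝟙𝔑 N + Q * N        ∎
    where
    open ℕP.≤-Reasoning
    E = sumBelow (λ i → tally (λ n → largePrimeTerm P n i) N) N
    tail-bound : P * E ≤ Q * N
    tail-bound = telescoping-bound P (λ j → tally (λ n → 𝟙∣ (j * (j ∸ 1)) (Q * n)) N) (Q * N) P≥1
      (λ i → tally-𝟙∣-Q*≤ Q (suc (P + i) * (P + i)) {{ℕ.>-nonZero (ℕP.*-mono-≤ {1} {suc (P + i)} {1} {P + i} (s≤s z≤n) (ℕP.≤-trans P≥1 (ℕP.m≤m+n P i)))}} N Q≥1) N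

  -- With P = Q k and T = P !, the T-periodic set A_P sandwiches 𝔑_Q up to an error Q N / P.
  tally𝔑-cauchy : ∀ k → 1 ≤ k → Σ ℕ λ M → ∀ m n → M ≤ m → M ≤ n →
                  k * tally 𝟙𝔑 (suc m) * suc n ≤ k * tally 𝟙𝔑 (suc n) * suc m + 3 * suc m * suc n
  tally𝔑-cauchy k k≥1 = k * T , λ m n kT≤m kT≤n →
    cross-multiplied-cauchy k T c Q (a (suc m)) (a (suc n)) (suc m) (suc n) {{ℕ.>-nonZero Q≥1}}
      (upper (suc m)) (lower (suc n)) (ℕP.≤-trans kT≤m (ℕP.n≤1+n m)) (ℕP.≤-trans kT≤n (ℕP.n≤1+n n))
    where
    P T : ℕ
    P = Q * k
    T = P !
    instance
      T≢0 : ℕ.NonZero T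
      T≢0 = P ℕP.!≢0
    a A : ℕ → ℕ
    a = tally 𝟙𝔑
    A = tally (𝟙A P)
    c : ℕ
    c = A T
    N≡ : ∀ N → N ≡ (N ℕDM./ T) * T + N ℕDM.% T
    N≡ N = trans (ℕDM.m≡m%n+[m/n]*n N T) (ℕP.+-comm (N ℕDM.% T) ((N ℕDM./ T) * T))
    A≡ : ∀ N → A N ≡ (N ℕDM./ T) * c + A (N ℕDM.% T)
    A≡ N = trans (cong A (N≡ N)) (tally-periodic (𝟙A P) T (𝟙A-periodic P) (N ℕDM./ T) (N ℕDM.% T))
    upper : ∀ N → a N * T ≤ c * N + T * T
    upper N = periodic-upper-bound (a N) (A N) c T N (N ℕDM./ T) (N ℕDM.% T) (A (N ℕDM.% T)) (N≡ N) (ℕDM.m%n<n N T) (A≡ N)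
      (tally≤ (𝟙A P) (N ℕDM.% T) (𝟙A≤1 P)) (tally-mono-≤ N (λ n n≥1 _ → 𝟙𝔑≤𝟙A P n n≥1))
    lower : ∀ N → P * c * N ≤ P * T * a N + Q * N * T + P * T * T
    lower N = periodic-lower-bound (a N) (A N) c T N (N ℕDM./ T) (N ℕDM.% T) (A (N ℕDM.% T)) P Q (N≡ N) (ℕDM.m%n<n N T) (A≡ N)
      (tally≤ (𝟙A P) T (𝟙A≤1 P)) (P*tally𝟙A≤ P N (ℕP.m≤m*n Q k {{ℕ.>-nonZero k≥1}}) (ℕP.*-mono-≤ {1} {Q} {1} {k} Q≥1 k≥1))

module MultiplesOf𝔫 where

  open import Data.Nat using (_*_; _∸_; _/_)
  open import Data.Nat.Divisibility using (_∣_; divides; _∣?_; *-cancelʳ-∣)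
  import Data.Nat.DivMod as ℕDM
  open import Data.Nat.GCD using (gcd; gcd[m,n]∣m; gcd[m,n]∣n)
  open import Data.Nat.LCM using (lcm-least)
  open import Data.Nat.Coprimality using (coprime-/gcd; coprime-divisor)
  open import Data.Nat.Primality using (Prime; prime?)
  open import Data.Product using (_,_)
  open import Relation.Nullary using (yes; no)
  open import Relation.Nullary.Decidable using (_×-dec_)
  open import Data.Nat.Tactic.RingSolver using (solve-∀)
  open Characterisation using (DivisorCondition)

  -- a / gcd a Q is coprime to Q / gcd a Q, which absorbs the factor Q of Q * n
  ∣Q*n⇒/gcd∣n : ∀ j Q n → suc j ∣ Q * n → (suc j / gcd (suc j) Q) {{gcdNZ j Q}} ∣ n
  ∣Q*n⇒/gcd∣n j Q n h = coprime-divisor (coprime-/gcd (suc j) Q) (*-cancelʳ-∣ g h′)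
    where
    instance
      g≢0 : ℕ.NonZero (gcd (suc j) Q)
      g≢0 = gcdNZ j Q
    g : ℕ
    g = gcd (suc j) Q
    h′ : suc j / g * g ∣ Q / g * n * g
    h′ = subst₂ _∣_ (sym (ℕDM.m/n*n≡m (gcd[m,n]∣m (suc j) Q)))
           (trans (cong (_* n) (sym (ℕDM.m/n*n≡m (gcd[m,n]∣n (suc j) Q)))) (lemma (Q / g) g n)) h
      where
      lemma : ∀ a b c → a * b * c ≡ a * c * b
      lemma = solve-∀

  term∣ : ∀ p (pr : Prime p) Q n → (p ∸ 1) ∣ Q * n → term p pr Q ∣ n
  term∣ (suc (suc j)) pr Q n h = ∣Q*n⇒/gcd∣n j Q n h

  lcmTerms∣ : ∀ Q n → DivisorCondition Q n → ∀ k → lcmTerms Q k ∣ n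
  lcmTerms∣ Q n cond zero    = divides n (sym (ℕP.*-identityʳ n))
  lcmTerms∣ Q n cond (suc k) with prime? (suc k) ×-dec (suc k ∣? Q)
  ... | yes (pr , p∣Q) = lcm-least (term∣ (suc k) pr Q n (cond (suc k) pr p∣Q)) (lcmTerms∣ Q n cond k)
  ... | no _           = lcmTerms∣ Q n cond k

  DivisorCondition⇒𝔫∣ : ∀ Q n → DivisorCondition Q n → 𝔫 Q ∣ n
  DivisorCondition⇒𝔫∣ zero           n cond = lcmTerms∣ zero n cond zero
  DivisorCondition⇒𝔫∣ (suc zero)     n cond = divides n (sym (ℕP.*-identityʳ n))
  DivisorCondition⇒𝔫∣ (suc (suc Q)) n cond = lcmTerms∣ (suc (suc Q)) n cond (suc (suc Q))

module UpperBound (Q : ℕ) (w : WeakPrimaryPseudoperfect Q) where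

  open import Data.Nat using (_+_; _*_; _≤_; _<_; _∸_; _/_; _%_; z≤n; s≤s)
  open import Data.Nat.Divisibility using (_∣_; _∣?_; ∣-trans; m∣m*n; n∣m*n; ∣n⇒∣m*n)
  import Data.Nat.DivMod as ℕDM
  open import Data.Product using (_,_; proj₁; proj₂)
  open import Data.Empty using (⊥-elim)
  open import Data.Nat.Primality using (Prime)
  open import Relation.Nullary using (¬_; yes; no)
  open import Data.Nat.Tactic.RingSolver using (solve-∀)
  open Primes using (∃prime∤; prime⇒≡2+)
  open Characterisation
  open Tally
  open Approximation Q w using (𝟙𝔑; in𝔑?)
  open MultiplesOf𝔫 using (DivisorCondition⇒𝔫∣)

  private
    Q≥1 : 1 ≤ Q
    Q≥1 = proj₁ w
    p₀ : ℕ
    p₀ = proj₁ (∃prime∤ Q Q≥1)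
    p₀-prime : Prime p₀
    p₀-prime = proj₁ (proj₂ (∃prime∤ Q Q≥1))
    p₀∤Q : ¬ p₀ ∣ Q
    p₀∤Q = proj₂ (proj₂ (∃prime∤ Q Q≥1))
    instance
      𝔫≢0′ : ℕ.NonZero (𝔫 Q)
      𝔫≢0′ = 𝔫≢0 Q

  -- No element of 𝔑_Q is divisible by p₀ (p₀ - 1), for a prime p₀ ∤ Q.
  L : ℕ
  L = 𝔫 Q * (p₀ * (p₀ ∸ 1))

  L≥1 : 1 ≤ L
  L≥1 with prime⇒≡2+ p₀-prime
  ... | q , e = ℕP.*-mono-≤ {1} {𝔫 Q} {1} (ℕ.>-nonZero⁻¹ (𝔫 Q)) (subst (λ z → 1 ≤ z * (z ∸ 1)) (sym e) (s≤s z≤n))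

  𝟙𝔑+𝟙∣L≤𝟙∣𝔫 : ∀ n → 1 ≤ n → 𝟙𝔑 n + 𝟙∣ L n ≤ 𝟙∣ (𝔫 Q) n
  𝟙𝔑+𝟙∣L≤𝟙∣𝔫 n n≥1 with in𝔑? n
  ... | no _ = indicator-mono (L ∣? n) (𝔫 Q ∣? n) (∣-trans (m∣m*n (p₀ * (p₀ ∸ 1))))
  ... | yes n∈𝔑 with L ∣? n | 𝔫 Q ∣? n
  ...   | yes L∣n | _ = ⊥-elim (In𝔑⇒NonDivisorCondition Q n Q≥1 n≥1 n∈𝔑 p₀ p₀-prime p₀∤Q
                          (∣-trans (∣n⇒∣m*n (𝔫 Q) (m∣m*n (p₀ ∸ 1))) L∣n) (∣n⇒∣m*n Q (∣-trans (∣n⇒∣m*n (𝔫 Q) (n∣m*n p₀)) L∣n)))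
  ...   | no _ | yes _    = s≤s z≤n
  ...   | no _ | no 𝔫∤n  = ⊥-elim (𝔫∤n (DivisorCondition⇒𝔫∣ Q n (In𝔑⇒DivisorCondition Q n Q≥1 n≥1 n∈𝔑)))

  -- #𝔑_Q ∩ [1, N] ≤ N / 𝔫 Q - ⌊N / L⌋ ≤ N / 𝔫 Q - N / (2 L), cross-multiplied
  tally𝔑-bound : ∀ N → 2 * L ≤ N → tally 𝟙𝔑 N * 𝔫 Q * (2 * L) + 𝔫 Q * N ≤ (2 * L) * N
  tally𝔑-bound N 2L≤N = begin
    a * 𝔫 Q * (2 * L) + 𝔫 Q * N           ≤⟨ ℕP.+-monoʳ-≤ (a * 𝔫 Q * (2 * L)) (ℕP.*-monoʳ-≤ (𝔫 Q) N≤2L*q) ⟩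
    a * 𝔫 Q * (2 * L) + 𝔫 Q * (2 * L * q) ≡⟨ lemma a (𝔫 Q) L q ⟩
    (2 * L) * ((a + q) * 𝔫 Q)             ≤⟨ ℕP.*-monoʳ-≤ (2 * L) (ℕP.≤-trans (ℕP.*-monoˡ-≤ (𝔫 Q) a+q≤) (tally-𝟙∣*d≤ (𝔫 Q) N)) ⟩
    (2 * L) * N                          ∎
    where
    open ℕP.≤-Reasoning
    instance
      L≢0 : ℕ.NonZero L
      L≢0 = ℕ.>-nonZero L≥1
    a = tally 𝟙𝔑 N
    q : ℕ
    q = N / L
    N≡ : N ≡ q * L + N % L
    N≡ = trans (ℕDM.m≡m%n+[m/n]*n N L) (ℕP.+-comm (N % L) (q * L))
    a+q≤ : a + q ≤ tally (𝟙∣ (𝔫 Q)) N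
    a+q≤ = subst (λ z → a + z ≤ tally (𝟙∣ (𝔫 Q)) N) (tally-𝟙∣ L N)
             (subst (_≤ tally (𝟙∣ (𝔫 Q)) N) (tally-distrib-+ 𝟙𝔑 (𝟙∣ L) N) (tally-mono-≤ N (λ n n≥1 _ → 𝟙𝔑+𝟙∣L≤𝟙∣𝔫 n n≥1)))
    q≥1 : 1 ≤ q
    q≥1 with q | N≡
    ... | zero  | e = ⊥-elim (ℕP.<⇒≱ (subst (_< L) (sym e) (ℕDM.m%n<n N L)) (ℕP.≤-trans (ℕP.m≤m+n L (L + 0)) 2L≤N))
    ... | suc _ | _ = s≤s z≤n
    N≤2L*q : N ≤ 2 * L * q
    N≤2L*q = begin
      N             ≡⟨ N≡ ⟩
      q * L + N % L ≤⟨ ℕP.+-monoʳ-≤ (q * L) (ℕP.≤-trans (ℕP.<⇒≤ (ℕDM.m%n<n N L)) (ℕP.m≤n*m L q {{ℕ.>-nonZero q≥1}})) ⟩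
      q * L + q * L ≡⟨ double q L ⟩
      2 * L * q     ∎
      where
      double : ∀ q L → q * L + q * L ≡ 2 * L * q
      double = solve-∀
    lemma : ∀ a n L q → a * n * (2 * L) + n * (2 * L * q) ≡ (2 * L) * ((a + q) * n)
    lemma = solve-∀

module Density (Q : ℕ) (w : WeakPrimaryPseudoperfect Q) where

  open import Data.Nat using (_+_; _*_; _≤_)
  open import Data.Integer using (+_; +≤+) renaming (_+_ to _+ᶻ_; _-_ to _-ᶻ_; _*_ to _*ᶻ_; _≤_ to _≤ᶻ_)
  open import Data.Rational as ℚ using (ℚ; 0ℚ; _<_; _-_; ∣_∣) renaming (_≤_ to _≤ℚ_)
  import Data.Rational.Properties as ℚP
  open import Data.Product using (Σ; _×_; ∃; _,_; proj₁; proj₂)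
  open import Data.Integer.Tactic.RingSolver using (solve-∀)
  open Tally using (tally)
  open RationalBounds
  open Approximation Q w using (𝟙𝔑; count≡tally; tally𝔑-cauchy)
  open UpperBound Q w using (L; L≥1; tally𝔑-bound)

  private
    pos-*-* : ∀ a b c → + (a * b * c) ≡ + a *ᶻ + b *ᶻ + c
    pos-*-* a b c = trans (ℤP.pos-* (a * b) c) (cong (_*ᶻ + c) (ℤP.pos-* a b))

    m≤n+o⇒m-n≤o : ∀ m n o → m ≤ n + o → + m -ᶻ + n ≤ᶻ + o
    m≤n+o⇒m-n≤o m n o h = subst (λ z → + m -ᶻ + n ≤ᶻ z) cancel (ℤP.+-monoˡ-≤ (ℤ.- + n) (+≤+ h))
      where
      lemma : ∀ n o → n +ᶻ o -ᶻ n ≡ o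
      lemma = solve-∀
      cancel : + (n + o) -ᶻ + n ≡ + o
      cancel = trans (cong (_-ᶻ + n) (ℤP.pos-+ n o)) (lemma (+ n) (+ o))

    m+n≤o⇒m≤o-n : ∀ m n o → m + n ≤ o → + m ≤ᶻ + o -ᶻ + n
    m+n≤o⇒m≤o-n m n o h = subst (_≤ᶻ + o -ᶻ + n) cancel (ℤP.+-monoˡ-≤ (ℤ.- + n) (+≤+ h))
      where
      lemma : ∀ m n → m +ᶻ n -ᶻ n ≡ m
      lemma = solve-∀
      cancel : + (m + n) -ᶻ + n ≡ + m
      cancel = trans (cong (_-ᶻ + n) (ℤP.pos-+ m n)) (lemma (+ m) (+ n))

    cross-ℕ⇒ℤ : ∀ a c b d k → k * a * d ≤ k * c * b + 3 * b * d →
                (+ a *ᶻ + d -ᶻ + c *ᶻ + b) *ᶻ + k ≤ᶻ + 3 *ᶻ + (b * d)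
    cross-ℕ⇒ℤ a c b d k h = subst₂ _≤ᶻ_ lhs rhs (m≤n+o⇒m-n≤o (k * a * d) (k * c * b) (3 * b * d) h)
      where
      lemma : ∀ k a d c b → k *ᶻ a *ᶻ d -ᶻ k *ᶻ c *ᶻ b ≡ (a *ᶻ d -ᶻ c *ᶻ b) *ᶻ k
      lemma = solve-∀
      lhs : + (k * a * d) -ᶻ + (k * c * b) ≡ (+ a *ᶻ + d -ᶻ + c *ᶻ + b) *ᶻ + k
      lhs = trans (cong₂ _-ᶻ_ (pos-*-* k a d) (pos-*-* k c b)) (lemma (+ k) (+ a) (+ d) (+ c) (+ b))
      rhs : + (3 * b * d) ≡ + 3 *ᶻ + (b * d)
      rhs = trans (pos-*-* 3 b d) (trans (ℤP.*-assoc (+ 3) (+ b) (+ d)) (cong (+ 3 *ᶻ_) (sym (ℤP.pos-* b d))))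

    upper-ℕ⇒ℤ : ∀ a n K N → a * n * K + n * N ≤ K * N →
                + a *ᶻ (+ n *ᶻ + K) ≤ᶻ (+ 1 *ᶻ + K -ᶻ + 1 *ᶻ + n) *ᶻ + N
    upper-ℕ⇒ℤ a n K N h = subst₂ _≤ᶻ_ lhs rhs (m+n≤o⇒m≤o-n (a * n * K) (n * N) (K * N) h)
      where
      lemma : ∀ k n x → k *ᶻ x -ᶻ n *ᶻ x ≡ (+ 1 *ᶻ k -ᶻ + 1 *ᶻ n) *ᶻ x
      lemma = solve-∀
      lhs : + (a * n * K) ≡ + a *ᶻ (+ n *ᶻ + K)
      lhs = trans (pos-*-* a n K) (ℤP.*-assoc (+ a) (+ n) (+ K))
      rhs : + (K * N) -ᶻ + (n * N) ≡ (+ 1 *ᶻ + K -ᶻ + 1 *ᶻ + n) *ᶻ + N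
      rhs = trans (cong₂ _-ᶻ_ (ℤP.pos-* K N) (ℤP.pos-* n N)) (lemma (+ K) (+ n) (+ N))

  ratio≡ : ∀ m → ratio Q m ≡ + tally 𝟙𝔑 (suc m) ℚ./ suc m
  ratio≡ m = cong (λ x → + x ℚ./ suc m) (count≡tally (suc m))

  private
    cross⇒difference≤ : ∀ k .{{_ : ℕ.NonZero k}} a c m n → k * a * suc n ≤ k * c * suc m + 3 * suc m * suc n →
                        + a ℚ./ suc m - + c ℚ./ suc n ≤ℚ + 3 ℚ./ k
    cross⇒difference≤ k a c m n h = x/b-y/d≤z/k (+ a) (+ c) (+ 3) (suc m) (suc n) k (cross-ℕ⇒ℤ a c (suc m) (suc n) k h)

    cross⇒-difference≤ : ∀ k .{{_ : ℕ.NonZero k}} a c m n → k * c * suc m ≤ k * a * suc n + 3 * suc n * suc m →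
                         ℚ.- (+ a ℚ./ suc m - + c ℚ./ suc n) ≤ℚ + 3 ℚ./ k
    cross⇒-difference≤ k a c m n h = -[x/b-y/d]≤z/k (+ a) (+ c) (+ 3) (suc m) (suc n) k
      (subst (λ z → (+ c *ᶻ + suc m -ᶻ + a *ᶻ + suc n) *ᶻ + k ≤ᶻ + 3 *ᶻ + z) (ℕP.*-comm (suc n) (suc m))
        (cross-ℕ⇒ℤ c a (suc n) (suc m) k h))

  ratio-cauchy : (ε : ℚ) → 0ℚ < ε → ∃ λ M → (m n : ℕ) → M ≤ m → M ≤ n → ∣ ratio Q m - ratio Q n ∣ ≤ℚ ε
  ratio-cauchy ε ε>0 = from-k (∃3/k≤ε ε ε>0)
    where
    a : ℕ → ℕ
    a m = tally 𝟙𝔑 (suc m)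
    from-k : (Σ ℕ λ k → Σ (ℕ.NonZero k) λ k≢0 → (+ 3 ℚ./ k) {{k≢0}} ≤ℚ ε) →
             ∃ λ M → (m n : ℕ) → M ≤ m → M ≤ n → ∣ ratio Q m - ratio Q n ∣ ≤ℚ ε
    from-k (k , k≢0 , 3/k≤ε) = M , λ m n M≤m M≤n →
      -- explicit endpoints keep the unifier from unfolding ratio into the decision procedure of count
      subst₂ (λ u v → ∣ u - v ∣ ≤ℚ ε) {x = + a m ℚ./ suc m} {y = ratio Q m} {u = + a n ℚ./ suc n} {v = ratio Q n}
        (sym (ratio≡ m)) (sym (ratio≡ n))
        (∣p∣≤q (+ a m ℚ./ suc m - + a n ℚ./ suc n) ε
          (ℚP.≤-trans (cross⇒difference≤ k {{k≢0}} (a m) (a n) m n (cauchy m n M≤m M≤n)) 3/k≤ε)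
          (ℚP.≤-trans (cross⇒-difference≤ k {{k≢0}} (a m) (a n) m n (cauchy n m M≤n M≤m)) 3/k≤ε))
      where
      M : ℕ
      M = proj₁ (tally𝔑-cauchy k (ℕ.>-nonZero⁻¹ k {{k≢0}}))
      cauchy : ∀ m n → M ≤ m → M ≤ n → k * a m * suc n ≤ k * a n * suc m + 3 * suc m * suc n
      cauchy = proj₂ (tally𝔑-cauchy k (ℕ.>-nonZero⁻¹ k {{k≢0}}))

  ratio-eventually-below : ∃ λ ε → 0ℚ < ε × (∃ λ M → (m : ℕ) → M ≤ m → ratio Q m ≤ℚ inv𝔫 Q - ε)
  ratio-eventually-below = + 1 ℚ./ (2 * L) , 0<1/n (2 * L) , 2 * L , λ m 2L≤m →
    subst (_≤ℚ inv𝔫 Q - + 1 ℚ./ (2 * L)) {x = + tally 𝟙𝔑 (suc m) ℚ./ suc m} {y = ratio Q m} (sym (ratio≡ m))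
      (x/b≤y/d-z/k (+ tally 𝟙𝔑 (suc m)) (+ 1) (+ 1) (suc m) (𝔫 Q) (2 * L) {{_}} {{𝔫≢0 Q}}
        (upper-ℕ⇒ℤ (tally 𝟙𝔑 (suc m)) (𝔫 Q) (2 * L) (suc m) (tally𝔑-bound (suc m) (ℕP.≤-trans 2L≤m (ℕP.n≤1+n m)))))
    where
    instance
      2L≢0 : ℕ.NonZero (2 * L)
      2L≢0 = ℕ.>-nonZero (ℕP.≤-trans L≥1 (ℕP.m≤m+n L (L + 0)))

open import Data.Nat using (_≤_)
open import Data.Rational using (ℚ; 0ℚ; _<_; _-_; ∣_∣) renaming (_≤_ to _≤ℚ_)
open import Data.Product using (_×_; ∃)
open import Data.Product using (_,_)

proposition7 : (Q : ℕ) → WeakPrimaryPseudoperfect Q →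
    ((ε : ℚ) → 0ℚ < ε → ∃ λ M → (m n : ℕ) → M ≤ m → M ≤ n →
    ∣ ratio Q m - ratio Q n ∣ ≤ℚ ε)
    × (∃ λ ε → 0ℚ < ε × (∃ λ M → (m : ℕ) → M ≤ m →
    ratio Q m ≤ℚ inv𝔫 Q - ε))
proposition7 Q w = Density.ratio-cauchy Q w , Density.ratio-eventually-below Q w
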